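{- Let $G$ be the $n\times n$ grid and $I$ an independent set of $G$. If $I$ has a fault line $F$ with no alternation points, then $I$ also has a fault line $F'$ such that either $F'$ or its reversal, viewed (after rotating by $45^\circ$ and translating so that it starts at the origin) as a walk in the Manhattan lattice $\vec{\mathbb{Z}}^2$, is a taxi walk.
   Context: $G_\Diamond$ is the graph whose vertices are the midpoints of edges of $G$, two being adjacent iff they are midpoints of two incident, perpendicular edges of $G$; rotated by $45^\circ$ it is a region of a square lattice. Orient each edge of $G_\Diamond$ as follows: it corresponds to two edges of $G$ sharing a vertex $w$; orient it clockwise around $w$ if $w$ is even (coordinate sum even) and counterclockwise if $w$ is odd. Under the rotation this orientation agrees with the Manhattan lattice $\vec{\mathbb{Z}}^2$: the orientation of $\mathbb{Z}^2$ in which an edge parallel to the $x$-axis is oriented in the positive $x$-direction if its $y$-coordinate is even and negatively otherwise, and an edge parallel to the $y$-axis is oriented in the positive $y$-direction if its $x$-coordinate is even and negatively otherwise. A taxi walk is an oriented walk in $\vec{\mathbb{Z}}^2$ starting at the origin that never revisits a vertex and never takes two left turns or two right turns in a row. Given an independent set $I$, a spanning path is a simple path in $G_\Diamond$ from the top boundary to the bottom boundary or from the left boundary to the right boundary, each of whose vertices is the midpoint of an edge of $G$ both of whose endpoints are unoccupied in $I$. Each vertex $v$ of such a path is colored blue if the odd endpoint of the edge $e_v$ it bisects lies to the left of the path as the path passes $v$, and red otherwise; an alternation point is a place where the color changes along the path. A fault line is a spanning path with zero or one alternation points. -}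

module Defs where

open import Data.Nat as ℕ using (ℕ; zero; suc)
open import Data.Integer as ℤ using (ℤ; +_; _+_; _-_; _*_; 0ℤ; 1ℤ; -1ℤ)
open import Data.Integer.DivMod using (_/ℕ_)
open import Data.Product using (∃-syntax; _×_; _,_; proj₁; proj₂)
open import Data.Sum using (_⊎_)
open import Relation.Binary.PropositionalEquality using (_≡_)
open import Relation.Nullary using (¬_)

Pt : Set
Pt = ℤ × ℤ

_⊕_ : Pt → Pt → Pt
(a , b) ⊕ (c , d) = (a + c , b + d)

_⊖_ : Pt → Pt → Pt
(a , b) ⊖ (c , d) = (a - c , b - d)

-- z-component of the cross product; positive iff the second vector points
-- to the left of the first (y-axis pointing up)
cross : Pt → Pt → ℤ
cross (a , b) (c , d) = a * d - b * c

dot : Pt → Pt → ℤ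
dot (a , b) (c , d) = a * c + b * d

UnitAxis : Pt → Set
UnitAxis d = d ≡ (1ℤ , 0ℤ) ⊎ d ≡ (-1ℤ , 0ℤ) ⊎ d ≡ (0ℤ , 1ℤ) ⊎ d ≡ (0ℤ , -1ℤ)

EvenZ : ℤ → Set
EvenZ x = ∃[ k ] (x ≡ + 2 * k)

OddZ : ℤ → Set
OddZ x = ∃[ k ] (x ≡ + 2 * k + 1ℤ)

-- The n × n grid G, in DOUBLED coordinates:
-- vertex (i , j), 0 ≤ i , j < n, is the point (2i , 2j); hence the midpoint
-- of an edge of G is a point with integer coordinates.

GVert : ℕ → Pt → Set
GVert n p = ∃[ i ] ∃[ j ] (i ℕ.< n × j ℕ.< n × p ≡ (+ (2 ℕ.* i) , + (2 ℕ.* j)))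

GAdj : ℕ → Pt → Pt → Set
GAdj n p q = GVert n p × GVert n q × ∃[ d ] (UnitAxis d × q ≡ p ⊕ (d ⊕ d))

OddVert : Pt → Set
OddVert p = ∃[ i ] ∃[ j ] (p ≡ (+ 2 * i , + 2 * j) × OddZ (i + j))

IndependentSet : ℕ → (Pt → Set) → Set
IndependentSet n I =
  (∀ p → I p → GVert n p) × (∀ p q → GAdj n p q → I p → ¬ I q)

Mid : ℕ → Pt → Set
Mid n m = ∃[ e ] (UnitAxis e × GVert n (m ⊖ e) × GVert n (m ⊕ e))

EndOf : ℕ → Pt → Pt → Set
EndOf n m p = GVert n p × UnitAxis (p ⊖ m)

DAdj : ℕ → Pt → Pt → Set
DAdj n m m' = Mid n m × Mid n m' ×
  ∃[ w ] (EndOf n m w × EndOf n m' w × dot (m ⊖ w) (m' ⊖ w) ≡ 0ℤ)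

Unoccupied : ℕ → (Pt → Set) → Pt → Set
Unoccupied n I m = ∀ p → EndOf n m p → ¬ I p

TopB BottomB LeftB RightB : ℕ → Pt → Set
TopB    n p = proj₂ p ≡ + (2 ℕ.* (n ℕ.∸ 1))
BottomB n p = proj₂ p ≡ 0ℤ
LeftB   n p = proj₁ p ≡ 0ℤ
RightB  n p = proj₁ p ≡ + (2 ℕ.* (n ℕ.∸ 1))

-- Paths are given by a length len and a map F : ℕ → Pt; the vertices of
-- the path are F 0 , F 1 , … , F len (values beyond len are irrelevant).

SpanningPath : ℕ → (Pt → Set) → ℕ → (ℕ → Pt) → Set
SpanningPath n I len F =
  (∀ i → i ℕ.≤ len → Mid n (F i) × Unoccupied n I (F i)) ×
  (∀ i → i ℕ.< len → DAdj n (F i) (F (suc i))) ×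
  (∀ i j → i ℕ.≤ len → j ℕ.≤ len → F i ≡ F j → i ≡ j) ×
  ((TopB n (F 0) × BottomB n (F len)) ⊎ (LeftB n (F 0) × RightB n (F len)))

-- The point p (off the path) lies to the left of the path F as it passes
-- its i-th vertex.  The path is drawn with straight segments between
-- consecutive midpoints; d₁ is the incoming, d₂ the outgoing direction.
-- At a left turn the left side is the convex wedge, at a right turn it is
-- the reflex wedge; at the endpoints only the single segment counts.
LeftOfPath : ℕ → (ℕ → Pt) → ℕ → Pt → Set
LeftOfPath len F i p =
    (i ≡ 0 × 0ℤ ℤ.< cross d₂ d)
  ⊎ (0 ℕ.< i × i ≡ len × 0ℤ ℤ.< cross d₁ d)
  ⊎ (0 ℕ.< i × i ℕ.< len ×
      ((0ℤ ℤ.≤ cross d₁ d₂ × 0ℤ ℤ.< cross d₁ d × 0ℤ ℤ.< cross d₂ d)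
       ⊎ (cross d₁ d₂ ℤ.< 0ℤ × (0ℤ ℤ.< cross d₁ d ⊎ 0ℤ ℤ.< cross d₂ d))))
  where
  d  = p ⊖ F i
  d₁ = F i ⊖ F (i ℕ.∸ 1)
  d₂ = F (suc i) ⊖ F i

Blue : ℕ → ℕ → (ℕ → Pt) → ℕ → Set
Blue n len F i = ∀ p → EndOf n (F i) p → OddVert p → LeftOfPath len F i p

AltAt : ℕ → ℕ → (ℕ → Pt) → ℕ → Set
AltAt n len F i = ¬ ((Blue n len F i → Blue n len F (suc i)) ×
                     (Blue n len F (suc i) → Blue n len F i))

FaultLine : ℕ → (Pt → Set) → ℕ → (ℕ → Pt) → Set
FaultLine n I len F = SpanningPath n I len F ×
  (∀ i j → i ℕ.< len → j ℕ.< len → AltAt n len F i → AltAt n len F j → i ≡ j)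

NoAlternation : ℕ → ℕ → (ℕ → Pt) → Set
NoAlternation n len F = ∀ i → i ℕ.< len → ¬ AltAt n len F i

MEdge : Pt → Pt → Set
MEdge a b =
    (b ≡ a ⊕ (1ℤ , 0ℤ) × EvenZ (proj₂ a))
  ⊎ (b ≡ a ⊕ (-1ℤ , 0ℤ) × OddZ (proj₂ a))
  ⊎ (b ≡ a ⊕ (0ℤ , 1ℤ) × EvenZ (proj₁ a))
  ⊎ (b ≡ a ⊕ (0ℤ , -1ℤ) × OddZ (proj₁ a))

TaxiWalkFrom : ℕ → (ℕ → Pt) → Set
TaxiWalkFrom len q =
  (∀ i → i ℕ.< len → MEdge (q i) (q (suc i))) ×
  (∀ i j → i ℕ.≤ len → j ℕ.≤ len → q i ≡ q j → i ≡ j) ×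
  (∀ i → 0 ℕ.< i → suc i ℕ.< len →
     ¬ (0ℤ ℤ.< turn i × 0ℤ ℤ.< turn (suc i)) ×
     ¬ (turn i ℤ.< 0ℤ × turn (suc i) ℤ.< 0ℤ))
  where
  turn : ℕ → ℤ
  turn k = cross (q k ⊖ q (k ℕ.∸ 1)) (q (suc k) ⊖ q k)

-- the 45° rotation of G◇ (doubled coordinates) onto ℤ² under which the
-- orientation of G◇ agrees with the Manhattan lattice
rot : Pt → Pt
rot (x , y) = ((x + y + 1ℤ) /ℕ 2 , (y - x - 1ℤ) /ℕ 2)

reversePath : ℕ → (ℕ → Pt) → ℕ → Pt
reversePath len F i = F (len ℕ.∸ i)

module Submission where

-- We work in rotated coordinates: rot maps the midpoints of G (points with
-- odd coordinate sum) injectively into ℤ², G◇-adjacency becomes a unit step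
-- (dadj⇒rot-step, step⇒dadj), and the Manhattan orientation around a point
-- depends only on its parity class.  Whether a path vertex is blue depends
-- only on its class and its incoming and outgoing steps (blue⇔blueAt), so
-- without alternation points the Boolean colour code blueAt is constant, = s.
-- The path is then repaired by shortcuts (Excise) that keep it a spanning path
-- of unoccupied midpoints and shorten it (repair):
--   phase 1 (orient): a step against orientation s is the middle of a U-turn,
--     shortcut by one step; colours stay s (ColourShortcut);
--   phase 2 (straighten): with all steps s-oriented, two equal turns in a row
--     form a U-turn away from the boundary (OrientedUTurn), bypassed together
--     with its neighbouring steps by one s-oriented step (UTurnBypass).
-- Finally an s-oriented path is a fault line without alternation points, and
-- without double turns it is a taxi walk, forwards if s is true and backwards
-- otherwise (TaxiWalks).

open import Defs
open import Data.Nat as ℕ using (ℕ; zero; suc; _≤ᵇ_)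
import Data.Nat.Properties as ℕP
import Data.Nat.DivMod as ℕD
open import Data.Nat.Induction using (<-rec)
open import Data.Integer as ℤ using (ℤ; +_; -[1+_]; _+_; _-_; _*_; 0ℤ; 1ℤ; -1ℤ; -_)
import Data.Integer.Properties as ℤP
open import Data.Integer.DivMod using (_/ℕ_)
open import Data.Integer.Tactic.RingSolver using (solve-∀)
open import Data.Bool using (Bool; true; false; not; _xor_; T; if_then_else_)
open import Data.Bool.Properties using (xor-same; not-involutive; not-distribˡ-xor)
import Data.Bool.Properties as BP
open import Data.List as List using (List; []; _∷_; cartesianProduct)
open import Data.List.Membership.Propositional using (_∈_)
open import Data.List.Membership.Propositional.Properties using (∈-map⁺; ∈-cartesianProduct⁺)
open import Data.List.Relation.Unary.Any using (here; there)
import Data.List.Relation.Unary.Any as Any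
import Data.List.Relation.Unary.All as All
open import Data.Product using (∃-syntax; Σ; _×_; _,_; proj₁; proj₂; curry)
import Data.Product.Properties as ProdP
open import Data.Sum using (_⊎_; inj₁; inj₂)
open import Data.Empty using (⊥; ⊥-elim)
open import Data.Maybe as Maybe using (Maybe; just; nothing)
import Data.Maybe.Properties as MaybeP
open import Relation.Binary.PropositionalEquality
open import Relation.Binary.Definitions using (DecidableEquality; tri<; tri≈; tri>)
open import Relation.Nullary using (¬_)
open import Relation.Nullary.Decidable as Dec
  using (Dec; yes; no; ¬?; _×-dec_; _⊎-dec_; _→-dec_; True; toWitness; fromWitness)
open import Relation.Unary using (Decidable)
open import Function.Bundles using (_⇔_; mk⇔; Equivalence)

cong₃ : ∀ {A B C D : Set} (f : A → B → C → D) {a a' b b' c c'} → a ≡ a' → b ≡ b' → c ≡ c' → f a b c ≡ f a' b' c'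
cong₃ f refl refl refl = refl

_≟ᵇ_ : DecidableEquality Bool
_≟ᵇ_ = BP._≟_

infix 4 _≟ᵇ_ _≟ᵈ_ _≟ᵐ_ _≟ₚ_

parℕ : ℕ → Bool
parℕ zero = false
parℕ (suc n) = not (parℕ n)

par : ℤ → Bool
par (+ n) = parℕ n
par -[1+ n ] = not (parℕ n)

parℕ-+ : ∀ m n → parℕ (m ℕ.+ n) ≡ parℕ m xor parℕ n
parℕ-+ zero n = refl
parℕ-+ (suc m) n rewrite parℕ-+ m n = not-distribˡ-xor (parℕ m) (parℕ n)

parℕ-2* : ∀ i → parℕ (2 ℕ.* i) ≡ false
parℕ-2* i = trans (parℕ-+ i (i ℕ.+ 0))
  (trans (cong (λ z → parℕ i xor parℕ z) (ℕP.+-identityʳ i)) (xor-same (parℕ i)))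

not-xor-not : ∀ a b → not a xor not b ≡ a xor b
not-xor-not false b = not-involutive b
not-xor-not true b = refl

par-⊖ : ∀ m n → par (m ℤ.⊖ n) ≡ parℕ m xor parℕ n
par-⊖ zero zero = refl
par-⊖ zero (suc n) = refl
par-⊖ (suc m) zero = sym (BP.xor-identityʳ _)
par-⊖ (suc m) (suc n) rewrite ℤP.[1+m]⊖[1+n]≡m⊖n m n | par-⊖ m n = sym (not-xor-not (parℕ m) (parℕ n))

par-+ : ∀ x y → par (x + y) ≡ par x xor par y
par-+ (+ m) (+ n) = parℕ-+ m n
par-+ (+ m) -[1+ n ] = par-⊖ m (suc n)
par-+ -[1+ m ] (+ n) = trans (par-⊖ n (suc m)) (BP.xor-comm (parℕ n) (not (parℕ m)))
par-+ -[1+ m ] -[1+ n ] = trans (not-involutive _) (trans (parℕ-+ m n) (sym (not-xor-not (parℕ m) (parℕ n))))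

par-neg : ∀ x → par (- x) ≡ par x
par-neg (+ zero) = refl
par-neg (+ suc n) = refl
par-neg -[1+ n ] = refl

par-2* : ∀ k → par (+ 2 * k) ≡ false
par-2* k = trans (cong par (2*k≡k+k k)) (trans (par-+ k k) (xor-same (par k)))
  where
  2*k≡k+k : ∀ k → + 2 * k ≡ k + k
  2*k≡k+k = solve-∀

OddZ⇒par : ∀ {x} → OddZ x → par x ≡ true
OddZ⇒par (k , refl) = trans (par-+ (+ 2 * k) 1ℤ) (cong (_xor true) (par-2* k))

bit : Bool → ℤ
bit false = 0ℤ
bit true = 1ℤ

half : ℕ → ℕ
half zero = zero
half (suc zero) = zero
half (suc (suc n)) = suc (half n)

half-spec : ∀ n → + n ≡ + 2 * + half n + bit (parℕ n)
half-spec zero = refl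
half-spec (suc zero) = refl
half-spec (suc (suc n)) rewrite not-involutive (parℕ n) =
  trans (cong (λ z → + 2 + z) (half-spec n)) (ring (+ half n) (bit (parℕ n)))
  where
  ring : ∀ h b → + 2 + (+ 2 * h + b) ≡ + 2 * (1ℤ + h) + b
  ring = solve-∀

par-decomp : ∀ x → Σ ℤ (λ k → x ≡ + 2 * k + bit (par x))
par-decomp (+ n) = + half n , half-spec n
par-decomp -[1+ n ] with half-spec (suc n)
... | eq with parℕ (suc n)
... | false = - (+ half (suc n)) , trans (cong -_ eq) (ring (+ half (suc n)))
  where
  ring : ∀ h → - (+ 2 * h + 0ℤ) ≡ + 2 * (- h) + 0ℤ
  ring = solve-∀
... | true = - (+ half (suc n)) - 1ℤ , trans (cong -_ eq) (ring (+ half (suc n)))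
  where
  ring : ∀ h → - (+ 2 * h + 1ℤ) ≡ + 2 * (- h - 1ℤ) + 1ℤ
  ring = solve-∀

par⇒EvenZ : ∀ x → par x ≡ false → EvenZ x
par⇒EvenZ x p with par-decomp x
... | k , eq rewrite p = k , trans eq (ℤP.+-identityʳ _)

par⇒OddZ : ∀ x → par x ≡ true → OddZ x
par⇒OddZ x p with par-decomp x
... | k , eq rewrite p = k , eq

neg-/ℕ2 : ∀ N → ℕ.suc N ℕ.% 2 ≡ 0 → -[1+ N ] /ℕ 2 ≡ - (+ (ℕ.suc N ℕ./ 2))
neg-/ℕ2 N eq with ℕ.suc N ℕ.% 2
... | zero = refl
... | suc r = ⊥-elim (ℕP.1+n≢0 eq)

[2*k]/ℕ2≡k : ∀ k → (+ 2 * k) /ℕ 2 ≡ k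
[2*k]/ℕ2≡k (+ n) = trans (cong (_/ℕ 2) (sym (ℤP.pos-* 2 n)))
  (cong +_ (trans (cong (ℕ._/ 2) (ℕP.*-comm 2 n)) (ℕD.m*n/n≡m n 2)))
[2*k]/ℕ2≡k -[1+ n ] =
  trans (neg-/ℕ2 (n ℕ.+ suc (n ℕ.+ 0)) (trans (cong (ℕ._% 2) (ℕP.*-comm 2 (suc n))) (ℕD.m*n%n≡0 (suc n) 2)))
        (cong (λ z → - (+ z)) (trans (cong (ℕ._/ 2) (ℕP.*-comm 2 (suc n))) (ℕD.m*n/n≡m (suc n) 2)))

≡pt : ∀ {a b c d : ℤ} → a ≡ c → b ≡ d → _≡_ {A = Pt} (a , b) (c , d)
≡pt = cong₂ _,_

data Dir : Set where
  R L U D : Dir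

dirv : Dir → Pt
dirv R = (1ℤ , 0ℤ)
dirv L = (-1ℤ , 0ℤ)
dirv U = (0ℤ , 1ℤ)
dirv D = (0ℤ , -1ℤ)

opp : Dir → Dir
opp R = L
opp L = R
opp U = D
opp D = U

opp-opp : ∀ v → opp (opp v) ≡ v
opp-opp R = refl
opp-opp L = refl
opp-opp U = refl
opp-opp D = refl

neg : Pt → Pt
neg (a , b) = (- a , - b)

⊕-assoc : ∀ p q r → (p ⊕ q) ⊕ r ≡ p ⊕ (q ⊕ r)
⊕-assoc (a , b) (c , d) (e , f) = ≡pt (ℤP.+-assoc a c e) (ℤP.+-assoc b d f)

⊕-comm : ∀ p q → p ⊕ q ≡ q ⊕ p
⊕-comm (a , b) (c , d) = ≡pt (ℤP.+-comm a c) (ℤP.+-comm b d)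

⊕-identityʳ : ∀ q → q ⊕ (0ℤ , 0ℤ) ≡ q
⊕-identityʳ (a , b) = ≡pt (ℤP.+-identityʳ a) (ℤP.+-identityʳ b)

⊕⊖-cancel : ∀ m v → (m ⊕ v) ⊖ m ≡ v
⊕⊖-cancel (x , y) (a , b) = ≡pt (ring x a) (ring y b)
  where
  ring : ∀ x a → x + a - x ≡ a
  ring = solve-∀

⊕⊖⊕-cancel : ∀ m f v → (m ⊕ f) ⊖ (m ⊕ v) ≡ f ⊖ v
⊕⊖⊕-cancel (x , y) (a , b) (c , d) = ≡pt (ring x a c) (ring y b d)
  where
  ring : ∀ x a c → x + a - (x + c) ≡ a - c
  ring = solve-∀

⊖⊕-neg : ∀ m f → m ⊖ (m ⊕ f) ≡ neg f
⊖⊕-neg (x , y) (a , b) = ≡pt (ring x a) (ring y b)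
  where
  ring : ∀ x a → x - (x + a) ≡ - a
  ring = solve-∀

⊖≡⊕neg : ∀ m e → m ⊖ e ≡ m ⊕ neg e
⊖≡⊕neg (x , y) (a , b) = ≡pt (ring x a) (ring y b)
  where
  ring : ∀ x a → x - a ≡ x + - a
  ring = solve-∀

⊖-flip : ∀ m w → m ⊖ w ≡ neg (w ⊖ m)
⊖-flip (x , y) (a , b) = ≡pt (ring x a) (ring y b)
  where
  ring : ∀ x a → x - a ≡ - (a - x)
  ring = solve-∀

⊕⊖-split : ∀ m p → p ≡ m ⊕ (p ⊖ m)
⊕⊖-split (x , y) (a , b) = ≡pt (ring x a) (ring y b)
  where
  ring : ∀ x a → a ≡ x + (a - x)
  ring = solve-∀

through : ∀ m m' w → m' ≡ m ⊕ ((w ⊖ m) ⊖ (w ⊖ m'))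
through (x , y) (x' , y') (a , b) = ≡pt (ring x x' a) (ring y y' b)
  where
  ring : ∀ x x' a → x' ≡ x + ((a - x) - (a - x'))
  ring = solve-∀

step-back : ∀ q v → (q ⊕ dirv v) ⊕ dirv (opp v) ≡ q
step-back q v = trans (⊕-assoc q (dirv v) (dirv (opp v))) (trans (cong (q ⊕_) (cancels v)) (⊕-identityʳ q))
  where
  cancels : ∀ v → dirv v ⊕ dirv (opp v) ≡ (0ℤ , 0ℤ)
  cancels R = refl
  cancels L = refl
  cancels U = refl
  cancels D = refl

step-back' : ∀ q v → (q ⊕ dirv (opp v)) ⊕ dirv v ≡ q
step-back' q v = subst (λ z → (q ⊕ dirv (opp v)) ⊕ dirv z ≡ q) (opp-opp v) (step-back q (opp v))

uturn-displacement : ∀ q x v → ((q ⊕ dirv x) ⊕ v) ⊕ dirv (opp x) ≡ q ⊕ v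
uturn-displacement q x v = begin
  ((q ⊕ dirv x) ⊕ v) ⊕ dirv (opp x)  ≡⟨ cong (_⊕ dirv (opp x)) (⊕-assoc q (dirv x) v) ⟩
  (q ⊕ (dirv x ⊕ v)) ⊕ dirv (opp x)  ≡⟨ cong (λ z → (q ⊕ z) ⊕ dirv (opp x)) (⊕-comm (dirv x) v) ⟩
  (q ⊕ (v ⊕ dirv x)) ⊕ dirv (opp x)  ≡⟨ cong (_⊕ dirv (opp x)) (sym (⊕-assoc q v (dirv x))) ⟩
  ((q ⊕ v) ⊕ dirv x) ⊕ dirv (opp x)  ≡⟨ step-back (q ⊕ v) x ⟩
  q ⊕ v                              ∎
  where open ≡-Reasoning

-- The rotation.  unrot is the inverse of rot on the midpoints of G (the points
-- with odd coordinate sum); a unit step u after rotation is the diagonal step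
-- dvec u before it.
dvec : Dir → Pt
dvec u = (proj₁ (dirv u) - proj₂ (dirv u) , proj₁ (dirv u) + proj₂ (dirv u))

unrot : Pt → Pt
unrot (a , b) = (a - b - 1ℤ , a + b)

unrot-⊕ : ∀ q o → unrot (q ⊕ o) ≡ unrot q ⊕ (proj₁ o - proj₂ o , proj₁ o + proj₂ o)
unrot-⊕ (a , b) (x , y) = ≡pt (ring₁ a b x y) (ring₂ a b x y)
  where
  ring₁ : ∀ a b x y → a + x - (b + y) - 1ℤ ≡ a - b - 1ℤ + (x - y)
  ring₁ = solve-∀
  ring₂ : ∀ a b x y → a + x + (b + y) ≡ a + b + (x + y)
  ring₂ = solve-∀

unrot-step : ∀ q u → unrot (q ⊕ dirv u) ≡ unrot q ⊕ dvec u
unrot-step q u = unrot-⊕ q (dirv u)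

rot-unrot : ∀ q → rot (unrot q) ≡ q
rot-unrot (a , b) = ≡pt (trans (cong (_/ℕ 2) (ring₁ a b)) ([2*k]/ℕ2≡k a))
                        (trans (cong (_/ℕ 2) (ring₂ a b)) ([2*k]/ℕ2≡k b))
  where
  ring₁ : ∀ a b → a - b - 1ℤ + (a + b) + 1ℤ ≡ + 2 * a
  ring₁ = solve-∀
  ring₂ : ∀ a b → a + b - (a - b - 1ℤ) - 1ℤ ≡ + 2 * b
  ring₂ = solve-∀

unrot-rot : ∀ x y → par (x + y) ≡ true → unrot (rot (x , y)) ≡ (x , y)
unrot-rot x y p with par-decomp (x + y)
... | k , x+y≡2k+1 rewrite p =
  trans (cong unrot (≡pt (trans (cong (_/ℕ 2) rot₁) ([2*k]/ℕ2≡k (k + 1ℤ)))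
                         (trans (cong (_/ℕ 2) rot₂) ([2*k]/ℕ2≡k (k - x)))))
        (≡pt (ring₁ k x) (trans (ring₂ k x) (sym (trans (ring₃ x y) (cong (_- x) x+y≡2k+1)))))
  where
  rot₁ : x + y + 1ℤ ≡ + 2 * (k + 1ℤ)
  rot₁ = trans (cong (_+ 1ℤ) x+y≡2k+1) (ring k)
    where
    ring : ∀ k → + 2 * k + 1ℤ + 1ℤ ≡ + 2 * (k + 1ℤ)
    ring = solve-∀
  rot₂ : y - x - 1ℤ ≡ + 2 * (k - x)
  rot₂ = trans (ringₐ x y) (trans (cong (λ z → z - + 2 * x - 1ℤ) x+y≡2k+1) (ringᵦ k x))
    where
    ringₐ : ∀ x y → y - x - 1ℤ ≡ (x + y) - + 2 * x - 1ℤ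
    ringₐ = solve-∀
    ringᵦ : ∀ k x → + 2 * k + 1ℤ - + 2 * x - 1ℤ ≡ + 2 * (k - x)
    ringᵦ = solve-∀
  ring₁ : ∀ k x → k + 1ℤ - (k - x) - 1ℤ ≡ x
  ring₁ = solve-∀
  ring₂ : ∀ k x → k + 1ℤ + (k - x) ≡ + 2 * k + 1ℤ - x
  ring₂ = solve-∀
  ring₃ : ∀ x y → y ≡ x + y - x
  ring₃ = solve-∀

par-unrot-y : ∀ a b → par (proj₂ (unrot (a , b))) ≡ par a xor par b
par-unrot-y a b = par-+ a b

par-unrot-x : ∀ a b → par (proj₁ (unrot (a , b))) ≡ not (par a xor par b)
par-unrot-x a b = trans (par-+ (a - b) -1ℤ)
  (trans (cong (_xor true) (trans (par-+ a (- b)) (cong (par a xor_) (par-neg b))))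
         (BP.xor-comm (par a xor par b) true))

-- The parity class of a rotated point determines the orientation of the
-- Manhattan lattice around it.
Class : Set
Class = Bool × Bool

classOf : Pt → Class
classOf (a , b) = (par a , par b)

classAfter : Class → Dir → Class
classAfter (α , β) u = (α xor par (proj₁ (dirv u)) , β xor par (proj₂ (dirv u)))

classOf-step : ∀ q u → classOf (q ⊕ dirv u) ≡ classAfter (classOf q) u
classOf-step (a , b) u = cong₂ _,_ (par-+ a _) (par-+ b _)

gridVertex-even : ∀ {n p} → GVert n p → par (proj₁ p) ≡ false × par (proj₂ p) ≡ false
gridVertex-even (i , j , _ , _ , refl) = parℕ-2* i , parℕ-2* j

mid-odd : ∀ {n m} → Mid n m → par (proj₁ m + proj₂ m) ≡ true
mid-odd {n} {x , y} (e , ue , gA , _) with gridVertex-even gA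
... | p1 , p2 = trans (cong par (ring x y (proj₁ e) (proj₂ e)))
    (trans (par-+ (x - proj₁ e + (y - proj₂ e)) _)
      (cong₂ _xor_ (trans (par-+ (x - proj₁ e) _) (cong₂ _xor_ p1 p2)) (unitAxis-odd ue)))
  where
  ring : ∀ x y a b → x + y ≡ (x - a + (y - b)) + (a + b)
  ring = solve-∀
  unitAxis-odd : ∀ {e} → UnitAxis e → par (proj₁ e + proj₂ e) ≡ true
  unitAxis-odd (inj₁ refl) = refl
  unitAxis-odd (inj₂ (inj₁ refl)) = refl
  unitAxis-odd (inj₂ (inj₂ (inj₁ refl))) = refl
  unitAxis-odd (inj₂ (inj₂ (inj₂ refl))) = refl

mid-unrot : ∀ {n m} → Mid n m → unrot (rot m) ≡ m
mid-unrot {n} {x , y} md = unrot-rot x y (mid-odd {n} {x , y} md)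

perpendicular-offsets : ∀ e1 e2 → UnitAxis e1 → UnitAxis e2 → dot (neg e1) (neg e2) ≡ 0ℤ → Σ Dir (λ u → e1 ⊖ e2 ≡ dvec u)
perpendicular-offsets _ _ (inj₁ refl) (inj₁ refl) ()
perpendicular-offsets _ _ (inj₁ refl) (inj₂ (inj₁ refl)) ()
perpendicular-offsets _ _ (inj₁ refl) (inj₂ (inj₂ (inj₁ refl))) _ = D , refl
perpendicular-offsets _ _ (inj₁ refl) (inj₂ (inj₂ (inj₂ refl))) _ = R , refl
perpendicular-offsets _ _ (inj₂ (inj₁ refl)) (inj₁ refl) ()
perpendicular-offsets _ _ (inj₂ (inj₁ refl)) (inj₂ (inj₁ refl)) ()
perpendicular-offsets _ _ (inj₂ (inj₁ refl)) (inj₂ (inj₂ (inj₁ refl))) _ = L , refl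
perpendicular-offsets _ _ (inj₂ (inj₁ refl)) (inj₂ (inj₂ (inj₂ refl))) _ = U , refl
perpendicular-offsets _ _ (inj₂ (inj₂ (inj₁ refl))) (inj₁ refl) _ = U , refl
perpendicular-offsets _ _ (inj₂ (inj₂ (inj₁ refl))) (inj₂ (inj₁ refl)) _ = R , refl
perpendicular-offsets _ _ (inj₂ (inj₂ (inj₁ refl))) (inj₂ (inj₂ (inj₁ refl))) ()
perpendicular-offsets _ _ (inj₂ (inj₂ (inj₁ refl))) (inj₂ (inj₂ (inj₂ refl))) ()
perpendicular-offsets _ _ (inj₂ (inj₂ (inj₂ refl))) (inj₁ refl) _ = L , refl
perpendicular-offsets _ _ (inj₂ (inj₂ (inj₂ refl))) (inj₂ (inj₁ refl)) _ = D , refl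
perpendicular-offsets _ _ (inj₂ (inj₂ (inj₂ refl))) (inj₂ (inj₂ (inj₁ refl))) ()
perpendicular-offsets _ _ (inj₂ (inj₂ (inj₂ refl))) (inj₂ (inj₂ (inj₂ refl))) ()

dadj⇒step : ∀ {n m m'} → DAdj n m m' → Σ Dir (λ u → m' ≡ m ⊕ dvec u)
dadj⇒step {n} {m} {m'} (_ , _ , w , (_ , u1) , (_ , u2) , dt) with perpendicular-offsets (w ⊖ m) (w ⊖ m') u1 u2
  (trans (sym (cong₂ dot (⊖-flip m w) (⊖-flip m' w))) dt)
... | u , eq = u , trans (through m m' w) (cong (m ⊕_) eq)

dadj-via-corner : ∀ {n m m' v} → Mid n m → Mid n m' → m' ≡ m ⊕ v → (f : Pt) → GVert n (m ⊕ f) →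
  UnitAxis f → UnitAxis (f ⊖ v) → dot (neg f) (v ⊖ f) ≡ 0ℤ → DAdj n m m'
dadj-via-corner {n} {m} {m'} {v} md md' refl f g uf ufv dt =
  md , md' , m ⊕ f , (g , subst UnitAxis (sym (⊕⊖-cancel m f)) uf) ,
  (g , subst UnitAxis (sym (⊕⊖⊕-cancel m f v)) ufv) ,
  trans (cong₂ dot (⊖⊕-neg m f) (⊕⊖⊕-cancel m v f)) dt

gridVertex-⊖ : ∀ {n} m e → GVert n (m ⊖ e) → GVert n (m ⊕ neg e)
gridVertex-⊖ {n} m e g = subst (GVert n) (⊖≡⊕neg m e) g

step⇒dadj : ∀ {n} {m} {m'} u → Mid n m → Mid n m' → m' ≡ m ⊕ dvec u → DAdj n m m'
step⇒dadj {m = m} u md@(_ , inj₁ refl , gA , gB) md' eq with u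
... | R = dadj-via-corner md md' eq _ gB (inj₁ refl) (inj₂ (inj₂ (inj₂ refl))) refl
... | U = dadj-via-corner md md' eq _ (gridVertex-⊖ m (1ℤ , 0ℤ) gA) (inj₂ (inj₁ refl)) (inj₂ (inj₂ (inj₂ refl))) refl
... | L = dadj-via-corner md md' eq _ (gridVertex-⊖ m (1ℤ , 0ℤ) gA) (inj₂ (inj₁ refl)) (inj₂ (inj₂ (inj₁ refl))) refl
... | D = dadj-via-corner md md' eq _ gB (inj₁ refl) (inj₂ (inj₂ (inj₁ refl))) refl
step⇒dadj {m = m} u md@(_ , inj₂ (inj₁ refl) , gA , gB) md' eq with u
... | R = dadj-via-corner md md' eq _ (gridVertex-⊖ m (-1ℤ , 0ℤ) gA) (inj₁ refl) (inj₂ (inj₂ (inj₂ refl))) refl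
... | U = dadj-via-corner md md' eq _ gB (inj₂ (inj₁ refl)) (inj₂ (inj₂ (inj₂ refl))) refl
... | L = dadj-via-corner md md' eq _ gB (inj₂ (inj₁ refl)) (inj₂ (inj₂ (inj₁ refl))) refl
... | D = dadj-via-corner md md' eq _ (gridVertex-⊖ m (-1ℤ , 0ℤ) gA) (inj₁ refl) (inj₂ (inj₂ (inj₁ refl))) refl
step⇒dadj {m = m} u md@(_ , inj₂ (inj₂ (inj₁ refl)) , gA , gB) md' eq with u
... | R = dadj-via-corner md md' eq _ gB (inj₂ (inj₂ (inj₁ refl))) (inj₂ (inj₁ refl)) refl
... | U = dadj-via-corner md md' eq _ gB (inj₂ (inj₂ (inj₁ refl))) (inj₁ refl) refl
... | L = dadj-via-corner md md' eq _ (gridVertex-⊖ m (0ℤ , 1ℤ) gA) (inj₂ (inj₂ (inj₂ refl))) (inj₁ refl) refl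
... | D = dadj-via-corner md md' eq _ (gridVertex-⊖ m (0ℤ , 1ℤ) gA) (inj₂ (inj₂ (inj₂ refl))) (inj₂ (inj₁ refl)) refl
step⇒dadj {m = m} u md@(_ , inj₂ (inj₂ (inj₂ refl)) , gA , gB) md' eq with u
... | R = dadj-via-corner md md' eq _ (gridVertex-⊖ m (0ℤ , -1ℤ) gA) (inj₂ (inj₂ (inj₁ refl))) (inj₂ (inj₁ refl)) refl
... | U = dadj-via-corner md md' eq _ (gridVertex-⊖ m (0ℤ , -1ℤ) gA) (inj₂ (inj₂ (inj₁ refl))) (inj₁ refl) refl
... | L = dadj-via-corner md md' eq _ gB (inj₂ (inj₂ (inj₂ refl))) (inj₁ refl) refl
... | D = dadj-via-corner md md' eq _ gB (inj₂ (inj₂ (inj₂ refl))) (inj₂ (inj₁ refl)) refl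

dadj⇒rot-step : ∀ {n m m'} → DAdj n m m' → Σ Dir (λ u → rot m' ≡ rot m ⊕ dirv u)
dadj⇒rot-step {n} {m} {m'} adj@(mid-m , _) = u , (begin
    rot m'                        ≡⟨ cong rot m'≡m⊕u ⟩
    rot (m ⊕ dvec u)              ≡⟨ cong (λ z → rot (z ⊕ dvec u)) (sym (mid-unrot {n} {m} mid-m)) ⟩
    rot (unrot (rot m) ⊕ dvec u)  ≡⟨ cong rot (sym (unrot-step (rot m) u)) ⟩
    rot (unrot (rot m ⊕ dirv u))  ≡⟨ rot-unrot (rot m ⊕ dirv u) ⟩
    rot m ⊕ dirv u                ∎)
  where
  open ≡-Reasoning
  u = proj₁ (dadj⇒step adj)
  m'≡m⊕u = proj₂ (dadj⇒step adj)

-- The odd endpoint of the edge bisected by a midpoint: its offset from the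
-- midpoint is one of four axis vectors, determined by the parity class of the
-- rotated midpoint alone (oddOffset).
data Ax : Set where
  E N W S : Ax

axv : Ax → Pt
axv E = (1ℤ , 0ℤ)
axv N = (0ℤ , 1ℤ)
axv W = (-1ℤ , 0ℤ)
axv S = (0ℤ , -1ℤ)

toAx : ∀ {e} → UnitAxis e → Σ Ax (λ t → e ≡ axv t)
toAx (inj₁ refl) = E , refl
toAx (inj₂ (inj₁ refl)) = W , refl
toAx (inj₂ (inj₂ (inj₁ refl))) = N , refl
toAx (inj₂ (inj₂ (inj₂ refl))) = S , refl

fromAx : ∀ t → UnitAxis (axv t)
fromAx E = inj₁ refl
fromAx W = inj₂ (inj₁ refl)
fromAx N = inj₂ (inj₂ (inj₁ refl))
fromAx S = inj₂ (inj₂ (inj₂ refl))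

oppAx : Ax → Ax
oppAx E = W
oppAx W = E
oppAx N = S
oppAx S = N

neg-axv : ∀ t → neg (axv t) ≡ axv (oppAx t)
neg-axv E = refl
neg-axv W = refl
neg-axv N = refl
neg-axv S = refl

axisHalf : Ax → ℤ
axisHalf E = 0ℤ
axisHalf N = 0ℤ
axisHalf W = -1ℤ
axisHalf S = -1ℤ

axisHalf-spec : ∀ t → proj₁ (axv t) + proj₂ (axv t) - 1ℤ ≡ + 2 * axisHalf t
axisHalf-spec E = refl
axisHalf-spec N = refl
axisHalf-spec W = refl
axisHalf-spec S = refl

oddAxis : Class → Ax
oddAxis (true , true) = E
oddAxis (true , false) = N
oddAxis (false , false) = W
oddAxis (false , true) = S

oddOffset : Class → Pt
oddOffset c = axv (oddAxis c)

endpoint-coordinate-sum : ∀ a b i j t → + 2 * i ≡ a - b - 1ℤ + proj₁ (axv t) → + 2 * j ≡ a + b + proj₂ (axv t) →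
  i + j ≡ a + axisHalf t
endpoint-coordinate-sum a b i j t x≡ y≡ = ℤP.*-cancelˡ-≡ (+ 2) (i + j) (a + axisHalf t)
  (trans (ring₁ i j) (trans (cong₂ _+_ x≡ y≡) (trans (ring₂ a b (proj₁ (axv t)) (proj₂ (axv t)))
    (trans (cong (λ z → + 2 * a + z) (axisHalf-spec t)) (ring₃ a (axisHalf t))))))
  where
  ring₁ : ∀ i j → + 2 * (i + j) ≡ + 2 * i + + 2 * j
  ring₁ = solve-∀
  ring₂ : ∀ a b x y → a - b - 1ℤ + x + (a + b + y) ≡ + 2 * a + (x + y - 1ℤ)
  ring₂ = solve-∀
  ring₃ : ∀ a h → + 2 * a + + 2 * h ≡ + 2 * (a + h)
  ring₃ = solve-∀

endpoint-parity : ∀ {n} a b t → GVert n (unrot (a , b) ⊕ axv t) → (par a xor par b) xor par (proj₂ (axv t)) ≡ false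
endpoint-parity a b t g = trans (sym (trans (par-+ (a + b) _) (cong (_xor par (proj₂ (axv t))) (par-+ a b)))) (proj₂ (gridVertex-even g))

endpoint-odd : ∀ a b t {p} → p ≡ unrot (a , b) ⊕ axv t → OddVert p → par a xor par (axisHalf t) ≡ true
endpoint-odd a b t refl (i , j , eq , od) =
  trans (sym (par-+ a (axisHalf t))) (trans (cong par (sym (endpoint-coordinate-sum a b i j t (sym (cong proj₁ eq)) (sym (cong proj₂ eq))))) (OddZ⇒par od))

endpoint-odd⁻¹ : ∀ {n} a b t {p} → GVert n p → p ≡ unrot (a , b) ⊕ axv t → par a xor par (axisHalf t) ≡ true → OddVert p
endpoint-odd⁻¹ a b t (i , j , _ , _ , refl) eq pp =
  + i , + j , ≡pt (ℤP.pos-* 2 i) (ℤP.pos-* 2 j) ,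
  par⇒OddZ (+ i + + j) (trans (cong par (endpoint-coordinate-sum a b (+ i) (+ j) t
     (trans (sym (ℤP.pos-* 2 i)) (cong proj₁ eq)) (trans (sym (ℤP.pos-* 2 j)) (cong proj₂ eq))))
     (trans (par-+ a (axisHalf t)) pp))

oddAxis-unique : ∀ α β t → (α xor β) xor par (proj₂ (axv t)) ≡ false → α xor par (axisHalf t) ≡ true → oddAxis (α , β) ≡ t
oddAxis-unique true true E _ _ = refl
oddAxis-unique true false N _ _ = refl
oddAxis-unique false false W _ _ = refl
oddAxis-unique false true S _ _ = refl
oddAxis-unique true true N () _
oddAxis-unique true true W _ ()
oddAxis-unique true true S () _
oddAxis-unique true false E () _
oddAxis-unique true false W _ ()
oddAxis-unique true false S _ ()
oddAxis-unique false false E _ ()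
oddAxis-unique false false N _ ()
oddAxis-unique false false S () _
oddAxis-unique false true E _ ()
oddAxis-unique false true N _ ()
oddAxis-unique false true W () _

oddAxis-odd : ∀ α β → α xor par (axisHalf (oddAxis (α , β))) ≡ true
oddAxis-odd true true = refl
oddAxis-odd true false = refl
oddAxis-odd false false = refl
oddAxis-odd false true = refl

oddAxis-aligned : ∀ α β t → (α xor β) xor par (proj₂ (axv t)) ≡ false → oddAxis (α , β) ≡ t ⊎ oddAxis (α , β) ≡ oppAx t
oddAxis-aligned true true E _ = inj₁ refl
oddAxis-aligned true true W _ = inj₂ refl
oddAxis-aligned true false N _ = inj₁ refl
oddAxis-aligned true false S _ = inj₂ refl
oddAxis-aligned false false W _ = inj₁ refl
oddAxis-aligned false false E _ = inj₂ refl
oddAxis-aligned false true S _ = inj₁ refl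
oddAxis-aligned false true N _ = inj₂ refl
oddAxis-aligned true true N ()
oddAxis-aligned true true S ()
oddAxis-aligned true false E ()
oddAxis-aligned true false W ()
oddAxis-aligned false false N ()
oddAxis-aligned false false S ()
oddAxis-aligned false true E ()
oddAxis-aligned false true W ()

odd-endpoint-unique : ∀ {n} a b {p} → EndOf n (unrot (a , b)) p → OddVert p → p ≡ unrot (a , b) ⊕ oddOffset (par a , par b)
odd-endpoint-unique {n} a b {p} (g , ua) ov with toAx ua
... | t , et =
  let eqp = trans (⊕⊖-split (unrot (a , b)) p) (cong (unrot (a , b) ⊕_) et)
  in trans eqp (cong (λ z → unrot (a , b) ⊕ axv z)
       (sym (oddAxis-unique (par a) (par b) t (endpoint-parity a b t (subst (GVert n) eqp g)) (endpoint-odd a b t eqp ov))))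

odd-endpoint-exists : ∀ {n} a b → Mid n (unrot (a , b)) →
  EndOf n (unrot (a , b)) (unrot (a , b) ⊕ oddOffset (par a , par b)) × OddVert (unrot (a , b) ⊕ oddOffset (par a , par b))
odd-endpoint-exists {n} a b (e , ue , gA , gB) with toAx ue
... | t , refl with oddAxis-aligned (par a) (par b) t (endpoint-parity a b t gB)
... | inj₁ eqt rewrite eqt =
  (gB , subst UnitAxis (sym (⊕⊖-cancel (unrot (a , b)) (axv t))) (fromAx t)) ,
  endpoint-odd⁻¹ a b t gB refl (subst (λ z → par a xor par (axisHalf z) ≡ true) eqt (oddAxis-odd (par a) (par b)))
... | inj₂ eqt rewrite eqt =
  let gA' = subst (λ z → GVert n (unrot (a , b) ⊕ z)) (neg-axv t) (gridVertex-⊖ (unrot (a , b)) (axv t) gA)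
  in (gA' , subst UnitAxis (sym (⊕⊖-cancel (unrot (a , b)) (axv (oppAx t)))) (fromAx (oppAx t))) ,
     endpoint-odd⁻¹ a b (oppAx t) gA' refl (subst (λ z → par a xor par (axisHalf z) ≡ true) eqt (oddAxis-odd (par a) (par b)))

LeftAtTurn : Pt → Pt → Pt → Set
LeftAtTurn d₁ d₂ d = (0ℤ ℤ.≤ cross d₁ d₂ × 0ℤ ℤ.< cross d₁ d × 0ℤ ℤ.< cross d₂ d)
       ⊎ (cross d₁ d₂ ℤ.< 0ℤ × (0ℤ ℤ.< cross d₁ d ⊎ 0ℤ ℤ.< cross d₂ d))

leftAtTurn? : ∀ d₁ d₂ d → Dec (LeftAtTurn d₁ d₂ d)
leftAtTurn? d₁ d₂ d = ((0ℤ ℤ.≤? cross d₁ d₂) ×-dec (0ℤ ℤ.<? cross d₁ d) ×-dec (0ℤ ℤ.<? cross d₂ d))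
   ⊎-dec ((cross d₁ d₂ ℤ.<? 0ℤ) ×-dec ((0ℤ ℤ.<? cross d₁ d) ⊎-dec (0ℤ ℤ.<? cross d₂ d)))

LeftOf : ℕ → ℕ → Pt → Pt → Pt → Set
LeftOf len i d d₁ d₂ =
    (i ≡ 0 × 0ℤ ℤ.< cross d₂ d)
  ⊎ (0 ℕ.< i × i ≡ len × 0ℤ ℤ.< cross d₁ d)
  ⊎ (0 ℕ.< i × i ℕ.< len × LeftAtTurn d₁ d₂ d)

leftOf-start : ∀ len d d₁ d₂ → LeftOf len 0 d d₁ d₂ ⇔ (0ℤ ℤ.< cross d₂ d)
leftOf-start len d d₁ d₂ = mk⇔ left⇒ (λ h → inj₁ (refl , h))
  where
  left⇒ : LeftOf len 0 d d₁ d₂ → 0ℤ ℤ.< cross d₂ d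
  left⇒ (inj₁ (_ , h)) = h
  left⇒ (inj₂ (inj₁ (() , _)))
  left⇒ (inj₂ (inj₂ (() , _)))

leftOf-end : ∀ len i d d₁ d₂ → 0 ℕ.< i → i ≡ len → LeftOf len i d d₁ d₂ ⇔ (0ℤ ℤ.< cross d₁ d)
leftOf-end len i d d₁ d₂ p0 pl = mk⇔ left⇒ (λ h → inj₂ (inj₁ (p0 , pl , h)))
  where
  left⇒ : LeftOf len i d d₁ d₂ → 0ℤ ℤ.< cross d₁ d
  left⇒ (inj₁ (refl , _)) = ⊥-elim (ℕP.<-irrefl refl p0)
  left⇒ (inj₂ (inj₁ (_ , _ , h))) = h
  left⇒ (inj₂ (inj₂ (_ , q , _))) = ⊥-elim (ℕP.<-irrefl pl q)

leftOf-inner : ∀ len i d d₁ d₂ → 0 ℕ.< i → i ℕ.< len → LeftOf len i d d₁ d₂ ⇔ LeftAtTurn d₁ d₂ d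
leftOf-inner len i d d₁ d₂ p0 pl = mk⇔ left⇒ (λ h → inj₂ (inj₂ (p0 , pl , h)))
  where
  left⇒ : LeftOf len i d d₁ d₂ → LeftAtTurn d₁ d₂ d
  left⇒ (inj₁ (refl , _)) = ⊥-elim (ℕP.<-irrefl refl p0)
  left⇒ (inj₂ (inj₁ (_ , refl , _))) = ⊥-elim (ℕP.<-irrefl refl pl)
  left⇒ (inj₂ (inj₂ (_ , _ , h))) = h

blue⇔oddOffset : ∀ {n len} F i a b → Mid n (F i) → F i ≡ unrot (a , b) →
  Blue n len F i ⇔ LeftOf len i (oddOffset (par a , par b)) (F i ⊖ F (i ℕ.∸ 1)) (F (suc i) ⊖ F i)
blue⇔oddOffset {n} {len} F i a b md eq = mk⇔ to from
  where
  m = unrot (a , b)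
  mid-m : Mid n m
  mid-m = subst (Mid n) eq md
  odd = m ⊕ oddOffset (par a , par b)
  odd-offset : odd ⊖ F i ≡ oddOffset (par a , par b)
  odd-offset = trans (cong (odd ⊖_) eq) (⊕⊖-cancel m _)
  to : Blue n len F i → LeftOf len i (oddOffset (par a , par b)) (F i ⊖ F (i ℕ.∸ 1)) (F (suc i) ⊖ F i)
  to bl = subst (λ z → LeftOf len i z (F i ⊖ F (i ℕ.∸ 1)) (F (suc i) ⊖ F i)) odd-offset
     (bl odd (subst (λ z → EndOf n z odd) (sym eq) (proj₁ (odd-endpoint-exists a b mid-m))) (proj₂ (odd-endpoint-exists a b mid-m)))
  from : LeftOf len i (oddOffset (par a , par b)) (F i ⊖ F (i ℕ.∸ 1)) (F (suc i) ⊖ F i) → Blue n len F i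
  from h p ep op = subst (λ z → LeftOf len i z (F i ⊖ F (i ℕ.∸ 1)) (F (suc i) ⊖ F i))
     (sym (trans (cong (_⊖ F i) (odd-endpoint-unique a b (subst (λ z → EndOf n z p) eq ep) op)) odd-offset)) h

record Finite (A : Set) : Set where
  field
    elements : List A
    complete : ∀ a → a ∈ elements

open Finite

∀? : {A : Set} (fin : Finite A) {P : A → Set} → Decidable P → Dec (∀ a → P a)
∀? fin P? = Dec.map′ (λ all a → All.lookup all (complete fin a)) (λ f → All.tabulate (λ {a} _ → f a))
  (All.all? P? (elements fin))

∃? : {A : Set} (fin : Finite A) {P : A → Set} → Decidable P → Dec (Σ A P)
∃? fin P? = Dec.map′ Any.satisfied (λ (a , pa) → Any.map (λ { refl → pa }) (complete fin a))
  (Any.any? P? (elements fin))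

by-exhaustion : {A : Set} (fin : Finite A) (P : A → Set) (P? : Decidable P) → {True (∀? fin P?)} → ∀ a → P a
by-exhaustion fin P P? {ok} = toWitness ok

finite-bool : Finite Bool
finite-bool = record { elements = true ∷ false ∷ [] ; complete = λ { true → here refl ; false → there (here refl) } }

finite-maybe : {A : Set} → Finite A → Finite (Maybe A)
finite-maybe fin = record
  { elements = nothing ∷ List.map just (elements fin)
  ; complete = λ { nothing → here refl ; (just a) → there (∈-map⁺ just (complete fin a)) } }

infixr 2 _×ᶠ_
_×ᶠ_ : {A B : Set} → Finite A → Finite B → Finite (A × B)
finA ×ᶠ finB = record
  { elements = cartesianProduct (elements finA) (elements finB)
  ; complete = λ (a , b) → ∈-cartesianProduct⁺ (complete finA a) (complete finB b) }

dirCode : Dir → ℕ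
dirCode R = 0
dirCode L = 1
dirCode U = 2
dirCode D = 3

dirOfCode : ℕ → Dir
dirOfCode 0 = R
dirOfCode 1 = L
dirOfCode 2 = U
dirOfCode _ = D

dirOfCode-dirCode : ∀ x → dirOfCode (dirCode x) ≡ x
dirOfCode-dirCode R = refl
dirOfCode-dirCode L = refl
dirOfCode-dirCode U = refl
dirOfCode-dirCode D = refl

_≟ᵈ_ : DecidableEquality Dir
x ≟ᵈ y = Dec.map′ injective (cong dirCode) (dirCode x ℕ.≟ dirCode y)
  where
  injective : dirCode x ≡ dirCode y → x ≡ y
  injective e = trans (sym (dirOfCode-dirCode x)) (trans (cong dirOfCode e) (dirOfCode-dirCode y))

_≟ᵐ_ : DecidableEquality (Maybe Dir)
_≟ᵐ_ = MaybeP.≡-dec _≟ᵈ_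

_≟ₚ_ : DecidableEquality Pt
_≟ₚ_ = ProdP.≡-dec ℤ._≟_ ℤ._≟_

finite-dir : Finite Dir
finite-dir = record
  { elements = R ∷ L ∷ U ∷ D ∷ []
  ; complete = λ { R → here refl ; L → there (here refl) ; U → there (there (here refl))
                 ; D → there (there (there (here refl))) } }

finite-class : Finite Class
finite-class = finite-bool ×ᶠ finite-bool

unitDir : Pt → Maybe Dir
unitDir v = Maybe.map proj₁ (Dec.dec⇒maybe (∃? finite-dir (λ x → v ≟ₚ dirv x)))

-- the direction of the step from a to b; opaque so that it is only ever
-- used through stepDir-⊕
opaque
  stepDir : Pt → Pt → Maybe Dir
  stepDir a b = unitDir (b ⊖ a)

  stepDir-⊕ : ∀ a u → stepDir a (a ⊕ dirv u) ≡ just u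
  stepDir-⊕ a u = trans (cong unitDir (⊕⊖-cancel a (dirv u))) (unitDir-dirv u)
    where
    unitDir-dirv : ∀ u → unitDir (dirv u) ≡ just u
    unitDir-dirv R = refl
    unitDir-dirv L = refl
    unitDir-dirv U = refl
    unitDir-dirv D = refl

-- Colour code of a path vertex of class c with incoming step x and outgoing
-- step y (nothing at an end of the path): true iff the odd endpoint of its
-- edge lies to the left of the path (blue⇔oddOffset).
blueᵇ : Class → Maybe Dir → Maybe Dir → Bool
blueᵇ c nothing (just u) = Dec.isYes (0ℤ ℤ.<? cross (dvec u) (oddOffset c))
blueᵇ c (just x) nothing = Dec.isYes (0ℤ ℤ.<? cross (dvec x) (oddOffset c))
blueᵇ c (just x) (just u) = Dec.isYes (leftAtTurn? (dvec x) (dvec u) (oddOffset c))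
blueᵇ c nothing nothing = false

-- a step u from a point of class c is an edge of the Manhattan lattice
-- (manhattan-edge); otherwise it goes against the Manhattan orientation
manhattanᵇ : Class → Dir → Bool
manhattanᵇ (α , β) R = not β
manhattanᵇ (α , β) L = β
manhattanᵇ (α , β) U = not α
manhattanᵇ (α , β) D = α

class₁ class₂ class₃ : Class → Dir → Dir → Class
class₁ c x u = classAfter c x
class₂ c x u = classAfter (class₁ c x u) u
class₃ c x u = classAfter (class₂ c x u) (opp x)

bypassDisplacement : Dir → Dir → Dir → Dir → Pt
bypassDisplacement w x u z = (((dirv w ⊕ dirv x) ⊕ dirv u) ⊕ dirv (opp x)) ⊕ dirv z

data UTurnVertex : Set where
  t0 t1 t2 t3 : UTurnVertex

finite-uturnVertex : Finite UTurnVertex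
finite-uturnVertex = record
  { elements = t0 ∷ t1 ∷ t2 ∷ t3 ∷ []
  ; complete = λ { t0 → here refl ; t1 → there (here refl) ; t2 → there (there (here refl))
                 ; t3 → there (there (there (here refl))) } }

uturnOffset : Dir → Dir → UTurnVertex → Pt
uturnOffset x u t0 = (0ℤ , 0ℤ)
uturnOffset x u t1 = dirv x
uturnOffset x u t2 = dirv x ⊕ dirv u
uturnOffset x u t3 = (dirv x ⊕ dirv u) ⊕ dirv (opp x)

Δx Δy : Pt → ℤ
Δx o = proj₁ o - proj₂ o
Δy o = proj₁ o + proj₂ o

yParity : Class → Bool
yParity (α , β) = α xor β

-- the conclusion of uturn-crosses-line: from the first vertex of the U-turn
-- x , u , opp x (class c), some vertex lies one unit above (if the first
-- vertex is on a horizontal grid line) resp. one unit left of it (vertical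
-- grid line); likewise some vertex lies one unit below resp. right of the last
-- vertex (class c₃)
Crossings : Class → Class → Dir → Dir → Set
Crossings c c₃ x u =
  (yParity c ≡ false → Σ UTurnVertex (λ t → Δy (uturnOffset x u t) ≡ 1ℤ)) ×
  (yParity c ≡ true → Σ UTurnVertex (λ t → Δx (uturnOffset x u t) ≡ -1ℤ)) ×
  (yParity c₃ ≡ false → Σ UTurnVertex (λ t → Δy (uturnOffset x u t) + 1ℤ ≡ Δy (uturnOffset x u t3))) ×
  (yParity c₃ ≡ true → Σ UTurnVertex (λ t → Δx (uturnOffset x u t) ≡ Δx (uturnOffset x u t3) + 1ℤ))

opaque
  manhattan-reverse : ∀ c u → manhattanᵇ (classAfter c u) (opp u) ≡ not (manhattanᵇ c u)
  manhattan-reverse = curry (by-exhaustion (finite-class ×ᶠ finite-dir)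
    (λ (c , u) → manhattanᵇ (classAfter c u) (opp u) ≡ not (manhattanᵇ c u))
    (λ (c , u) → manhattanᵇ (classAfter c u) (opp u) ≟ᵇ not (manhattanᵇ c u)))

  blue-at-start : ∀ c u → blueᵇ c nothing (just u) ≡ manhattanᵇ c u
  blue-at-start = curry (by-exhaustion (finite-class ×ᶠ finite-dir)
    (λ (c , u) → blueᵇ c nothing (just u) ≡ manhattanᵇ c u)
    (λ (c , u) → blueᵇ c nothing (just u) ≟ᵇ manhattanᵇ c u))

  blue-at-end : ∀ c x → blueᵇ (classAfter c x) (just x) nothing ≡ manhattanᵇ c x
  blue-at-end = curry (by-exhaustion (finite-class ×ᶠ finite-dir)
    (λ (c , x) → blueᵇ (classAfter c x) (just x) nothing ≡ manhattanᵇ c x)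
    (λ (c , x) → blueᵇ (classAfter c x) (just x) nothing ≟ᵇ manhattanᵇ c x))

  blue-interior : ∀ c x u → manhattanᵇ (classAfter c x) u ≡ manhattanᵇ c x → u ≢ opp x →
    blueᵇ (classAfter c x) (just x) (just u) ≡ manhattanᵇ c x
  blue-interior c x u = by-exhaustion (finite-class ×ᶠ finite-dir ×ᶠ finite-dir)
    (λ (c , x , u) → manhattanᵇ (classAfter c x) u ≡ manhattanᵇ c x → u ≢ opp x →
       blueᵇ (classAfter c x) (just x) (just u) ≡ manhattanᵇ c x)
    (λ (c , x , u) → manhattanᵇ (classAfter c x) u ≟ᵇ manhattanᵇ c x →-dec ¬? (u ≟ᵈ opp x) →-dec
       blueᵇ (classAfter c x) (just x) (just u) ≟ᵇ manhattanᵇ c x)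
    (c , x , u)

  -- A step against orientation s between two vertices coloured s is the middle
  -- step of a U-turn: the neighbouring steps exist and are opposite.
  misoriented-step-is-uturn : ∀ s c x u y → blueᵇ c x (just u) ≡ s → blueᵇ (classAfter c u) (just u) y ≡ s →
    manhattanᵇ c u ≢ s → x ≢ just (opp u) → y ≢ just (opp u) →
    Σ Dir (λ x' → x ≡ just x' × y ≡ just (opp x'))
  misoriented-step-is-uturn s c x u y = by-exhaustion
    (finite-bool ×ᶠ finite-class ×ᶠ finite-maybe finite-dir ×ᶠ finite-dir ×ᶠ finite-maybe finite-dir)
    (λ (s , c , x , u , y) → blueᵇ c x (just u) ≡ s → blueᵇ (classAfter c u) (just u) y ≡ s →
       manhattanᵇ c u ≢ s → x ≢ just (opp u) → y ≢ just (opp u) →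
       Σ Dir (λ x' → x ≡ just x' × y ≡ just (opp x')))
    (λ (s , c , x , u , y) → blueᵇ c x (just u) ≟ᵇ s →-dec blueᵇ (classAfter c u) (just u) y ≟ᵇ s →-dec
       ¬? (manhattanᵇ c u ≟ᵇ s) →-dec ¬? (x ≟ᵐ just (opp u)) →-dec ¬? (y ≟ᵐ just (opp u)) →-dec
       ∃? finite-dir (λ x' → (x ≟ᵐ just x') ×-dec (y ≟ᵐ just (opp x'))))
    (s , c , x , u , y)

  -- Replacing a U-turn x , u , opp x (entered by w, left by z) by the single
  -- step u keeps the colours s of its two remaining vertices.
  shortcut-keeps-colours : ∀ s c w x u z →
    blueᵇ c w (just x) ≡ s → blueᵇ (class₁ c x u) (just x) (just u) ≡ s →
    blueᵇ (class₂ c x u) (just u) (just (opp x)) ≡ s → blueᵇ (class₃ c x u) (just (opp x)) z ≡ s →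
    manhattanᵇ (class₁ c x u) u ≢ s →
    w ≢ just (opp u) → z ≢ just (opp u) → w ≢ just (opp x) → z ≢ just x → u ≢ opp x → u ≢ x →
    blueᵇ c w (just u) ≡ s × blueᵇ (class₃ c x u) (just u) z ≡ s
  shortcut-keeps-colours s c w x u z = by-exhaustion
    (finite-bool ×ᶠ finite-class ×ᶠ finite-maybe finite-dir ×ᶠ finite-dir ×ᶠ finite-dir ×ᶠ finite-maybe finite-dir)
    (λ (s , c , w , x , u , z) →
       blueᵇ c w (just x) ≡ s → blueᵇ (class₁ c x u) (just x) (just u) ≡ s →
       blueᵇ (class₂ c x u) (just u) (just (opp x)) ≡ s → blueᵇ (class₃ c x u) (just (opp x)) z ≡ s →
       manhattanᵇ (class₁ c x u) u ≢ s →
       w ≢ just (opp u) → z ≢ just (opp u) → w ≢ just (opp x) → z ≢ just x → u ≢ opp x → u ≢ x →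
       blueᵇ c w (just u) ≡ s × blueᵇ (class₃ c x u) (just u) z ≡ s)
    (λ (s , c , w , x , u , z) →
       blueᵇ c w (just x) ≟ᵇ s →-dec blueᵇ (class₁ c x u) (just x) (just u) ≟ᵇ s →-dec
       blueᵇ (class₂ c x u) (just u) (just (opp x)) ≟ᵇ s →-dec blueᵇ (class₃ c x u) (just (opp x)) z ≟ᵇ s →-dec
       ¬? (manhattanᵇ (class₁ c x u) u ≟ᵇ s) →-dec
       ¬? (w ≟ᵐ just (opp u)) →-dec ¬? (z ≟ᵐ just (opp u)) →-dec ¬? (w ≟ᵐ just (opp x)) →-dec
       ¬? (z ≟ᵐ just x) →-dec ¬? (u ≟ᵈ opp x) →-dec ¬? (u ≟ᵈ x) →-dec
       (blueᵇ c w (just u) ≟ᵇ s ×-dec blueᵇ (class₃ c x u) (just u) z ≟ᵇ s))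
    (s , c , w , x , u , z)

  two-lefts-reverse : ∀ x u y → 0ℤ ℤ.< cross (dirv x) (dirv u) → 0ℤ ℤ.< cross (dirv u) (dirv y) → y ≡ opp x
  two-lefts-reverse x u y = by-exhaustion (finite-dir ×ᶠ finite-dir ×ᶠ finite-dir)
    (λ (x , u , y) → 0ℤ ℤ.< cross (dirv x) (dirv u) → 0ℤ ℤ.< cross (dirv u) (dirv y) → y ≡ opp x)
    (λ (x , u , y) → 0ℤ ℤ.<? cross (dirv x) (dirv u) →-dec 0ℤ ℤ.<? cross (dirv u) (dirv y) →-dec y ≟ᵈ opp x)
    (x , u , y)

  two-rights-reverse : ∀ x u y → cross (dirv x) (dirv u) ℤ.< 0ℤ → cross (dirv u) (dirv y) ℤ.< 0ℤ → y ≡ opp x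
  two-rights-reverse x u y = by-exhaustion (finite-dir ×ᶠ finite-dir ×ᶠ finite-dir)
    (λ (x , u , y) → cross (dirv x) (dirv u) ℤ.< 0ℤ → cross (dirv u) (dirv y) ℤ.< 0ℤ → y ≡ opp x)
    (λ (x , u , y) → cross (dirv x) (dirv u) ℤ.<? 0ℤ →-dec cross (dirv u) (dirv y) ℤ.<? 0ℤ →-dec y ≟ᵈ opp x)
    (x , u , y)

  -- Five s-oriented steps w , x , u , opp x , z around a U-turn add up to a
  -- single s-oriented step, which can replace them.
  bypass-is-oriented : ∀ s c w x u z → manhattanᵇ c w ≡ s → manhattanᵇ (classAfter c w) x ≡ s →
    manhattanᵇ (class₁ (classAfter c w) x u) u ≡ s → manhattanᵇ (class₂ (classAfter c w) x u) (opp x) ≡ s →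
    manhattanᵇ (class₃ (classAfter c w) x u) z ≡ s →
    u ≢ x → u ≢ opp x → w ≢ opp x → w ≢ opp u → z ≢ x → z ≢ opp u →
    Σ Dir (λ v → bypassDisplacement w x u z ≡ dirv v × manhattanᵇ c v ≡ s)
  bypass-is-oriented s c w x u z = by-exhaustion
    (finite-bool ×ᶠ finite-class ×ᶠ finite-dir ×ᶠ finite-dir ×ᶠ finite-dir ×ᶠ finite-dir)
    (λ (s , c , w , x , u , z) → manhattanᵇ c w ≡ s → manhattanᵇ (classAfter c w) x ≡ s →
       manhattanᵇ (class₁ (classAfter c w) x u) u ≡ s → manhattanᵇ (class₂ (classAfter c w) x u) (opp x) ≡ s →
       manhattanᵇ (class₃ (classAfter c w) x u) z ≡ s →
       u ≢ x → u ≢ opp x → w ≢ opp x → w ≢ opp u → z ≢ x → z ≢ opp u →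
       Σ Dir (λ v → bypassDisplacement w x u z ≡ dirv v × manhattanᵇ c v ≡ s))
    (λ (s , c , w , x , u , z) → manhattanᵇ c w ≟ᵇ s →-dec manhattanᵇ (classAfter c w) x ≟ᵇ s →-dec
       manhattanᵇ (class₁ (classAfter c w) x u) u ≟ᵇ s →-dec manhattanᵇ (class₂ (classAfter c w) x u) (opp x) ≟ᵇ s →-dec
       manhattanᵇ (class₃ (classAfter c w) x u) z ≟ᵇ s →-dec
       ¬? (u ≟ᵈ x) →-dec ¬? (u ≟ᵈ opp x) →-dec ¬? (w ≟ᵈ opp x) →-dec ¬? (w ≟ᵈ opp u) →-dec
       ¬? (z ≟ᵈ x) →-dec ¬? (z ≟ᵈ opp u) →-dec
       ∃? finite-dir (λ v → (bypassDisplacement w x u z ≟ₚ dirv v) ×-dec (manhattanᵇ c v ≟ᵇ s)))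
    (s , c , w , x , u , z)

  -- An s-oriented U-turn crosses the grid lines through its end vertices, so
  -- it can neither start nor end on the boundary of the grid.
  uturn-crosses-line : ∀ s c x u → manhattanᵇ c x ≡ s → manhattanᵇ (class₁ c x u) u ≡ s →
    manhattanᵇ (class₂ c x u) (opp x) ≡ s → u ≢ x → u ≢ opp x →
    Crossings c (class₃ c x u) x u
  uturn-crosses-line s c x u = by-exhaustion (finite-bool ×ᶠ finite-class ×ᶠ finite-dir ×ᶠ finite-dir)
    (λ (s , c , x , u) → manhattanᵇ c x ≡ s → manhattanᵇ (class₁ c x u) u ≡ s →
       manhattanᵇ (class₂ c x u) (opp x) ≡ s → u ≢ x → u ≢ opp x →
       Crossings c (class₃ c x u) x u)
    (λ (s , c , x , u) → manhattanᵇ c x ≟ᵇ s →-dec manhattanᵇ (class₁ c x u) u ≟ᵇ s →-dec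
       manhattanᵇ (class₂ c x u) (opp x) ≟ᵇ s →-dec ¬? (u ≟ᵈ x) →-dec ¬? (u ≟ᵈ opp x) →-dec
       (yParity c ≟ᵇ false →-dec ∃? finite-uturnVertex (λ t → Δy (uturnOffset x u t) ℤ.≟ 1ℤ)) ×-dec
       (yParity c ≟ᵇ true →-dec ∃? finite-uturnVertex (λ t → Δx (uturnOffset x u t) ℤ.≟ -1ℤ)) ×-dec
       (yParity (class₃ c x u) ≟ᵇ false →-dec
          ∃? finite-uturnVertex (λ t → Δy (uturnOffset x u t) + 1ℤ ℤ.≟ Δy (uturnOffset x u t3))) ×-dec
       (yParity (class₃ c x u) ≟ᵇ true →-dec
          ∃? finite-uturnVertex (λ t → Δx (uturnOffset x u t) ℤ.≟ Δx (uturnOffset x u t3) + 1ℤ)))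
    (s , c , x , u)

inStep : (ℕ → Pt) → ℕ → Maybe Dir
inStep G zero = nothing
inStep G (suc i) = stepDir (G i) (G (suc i))

outStep : ℕ → (ℕ → Pt) → ℕ → Maybe Dir
outStep len G i = if i ℕ.≡ᵇ len then nothing else stepDir (G i) (G (suc i))

blueAt : ℕ → (ℕ → Pt) → ℕ → Bool
blueAt len G i = blueᵇ (classOf (G i)) (inStep G i) (outStep len G i)

manhattanStepᵇ : Class → Maybe Dir → Bool
manhattanStepᵇ c nothing = false
manhattanStepᵇ c (just u) = manhattanᵇ c u

manhattanAt : (ℕ → Pt) → ℕ → Bool
manhattanAt G i = manhattanStepᵇ (classOf (G i)) (stepDir (G i) (G (suc i)))

UniformColour : Bool → ℕ → (ℕ → Pt) → Set
UniformColour s len G = ∀ i → i ℕ.≤ len → blueAt len G i ≡ s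

UniformOrientation : Bool → ℕ → (ℕ → Pt) → Set
UniformOrientation s len G = ∀ i → i ℕ.< len → manhattanAt G i ≡ s

rotPath : (ℕ → Pt) → ℕ → Pt
rotPath F i = rot (F i)

outStep-last : ∀ len G → outStep len G len ≡ nothing
outStep-last len G rewrite Equivalence.to BP.T-≡ (ℕP.≡⇒≡ᵇ len len refl) = refl

outStep-inner : ∀ len G i → i ℕ.< len → outStep len G i ≡ stepDir (G i) (G (suc i))
outStep-inner len G i p with i ℕ.≡ᵇ len in e
... | false = refl
... | true = ⊥-elim (ℕP.<-irrefl (ℕP.≡ᵇ⇒≡ i len (subst T (sym e) _)) p)

module PathSteps {n : ℕ} {I : Pt → Set} {len : ℕ} {F : ℕ → Pt} (sp : SpanningPath n I len F) where
  open Equivalence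

  G : ℕ → Pt
  G = rotPath F

  mid : ∀ {i} → i ℕ.≤ len → Mid n (F i)
  mid {i} p = proj₁ (proj₁ sp i p)

  F≡unrot : ∀ {i} → i ℕ.≤ len → F i ≡ unrot (G i)
  F≡unrot p = sym (mid-unrot (mid p))

  opaque
    step : ∀ {i} → i ℕ.< len → Σ Dir (λ u → G (suc i) ≡ G i ⊕ dirv u)
    step {i} p = dadj⇒rot-step (proj₁ (proj₂ sp) i p)

  F-step : ∀ {i} (p : i ℕ.< len) → F (suc i) ⊖ F i ≡ dvec (proj₁ (step p))
  F-step {i} p = trans (cong₂ _⊖_ (F≡unrot p) (F≡unrot (ℕP.<⇒≤ p)))
     (trans (cong (_⊖ unrot (G i)) (trans (cong unrot (proj₂ (step p))) (unrot-step (G i) (proj₁ (step p)))))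
            (⊕⊖-cancel (unrot (G i)) _))

  rotPath-injective : ∀ {i j} → i ℕ.≤ len → j ℕ.≤ len → G i ≡ G j → i ≡ j
  rotPath-injective {i} {j} pi pj eq = proj₁ (proj₂ (proj₂ sp)) i j pi pj
    (trans (F≡unrot pi) (trans (cong unrot eq) (sym (F≡unrot pj))))

  stepDir-at : ∀ {i} (p : i ℕ.< len) → stepDir (G i) (G (suc i)) ≡ just (proj₁ (step p))
  stepDir-at {i} p = trans (cong (stepDir (G i)) (proj₂ (step p))) (stepDir-⊕ (G i) (proj₁ (step p)))

  manhattanAt-step : ∀ {i} (p : i ℕ.< len) → manhattanAt G i ≡ manhattanᵇ (classOf (G i)) (proj₁ (step p))
  manhattanAt-step {i} p = cong (manhattanStepᵇ (classOf (G i))) (stepDir-at p)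

  classOf-next : ∀ {i} (p : i ℕ.< len) → classOf (G (suc i)) ≡ classAfter (classOf (G i)) (proj₁ (step p))
  classOf-next {i} p = trans (cong classOf (proj₂ (step p))) (classOf-step (G i) (proj₁ (step p)))

  rot-step⇒dadj : ∀ {i j} v → i ℕ.≤ len → j ℕ.≤ len → G j ≡ G i ⊕ dirv v → DAdj n (F i) (F j)
  rot-step⇒dadj {i} {j} v pi pj eq = step⇒dadj v (mid pi) (mid pj)
    (trans (F≡unrot pj) (trans (cong unrot eq) (trans (unrot-step (G i) v) (cong (_⊕ dvec v) (sym (F≡unrot pi))))))

  blue-via : ∀ {i} (p : i ℕ.≤ len) {Q : Set} (Q? : Dec Q) →
    LeftOf len i (oddOffset (classOf (G i))) (F i ⊖ F (i ℕ.∸ 1)) (F (suc i) ⊖ F i) ⇔ Q →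
    blueAt len G i ≡ Dec.isYes Q? → Blue n len F i ⇔ T (blueAt len G i)
  blue-via {i} p Q? left⇔Q code = mk⇔
    (λ b → subst T (sym code) (fromWitness (to left⇔Q (to blue⇔left b))))
    (λ t → from blue⇔left (from left⇔Q (toWitness (subst T code t))))
    where
    blue⇔left = blue⇔oddOffset {n} {len} F i (proj₁ (G i)) (proj₂ (G i)) (mid p) (F≡unrot p)

  blue⇔blueAt : 0 ℕ.< len → ∀ i → i ℕ.≤ len → Blue n len F i ⇔ T (blueAt len G i)
  blue⇔blueAt l0 zero p = blue-via p (0ℤ ℤ.<? cross (dvec u) d)
      (subst (λ z → LeftOf len 0 d (F 0 ⊖ F 0) (F 1 ⊖ F 0) ⇔ (0ℤ ℤ.< cross z d)) (F-step l0)
             (leftOf-start len d (F 0 ⊖ F 0) (F 1 ⊖ F 0)))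
      (cong (blueᵇ (classOf (G 0)) nothing) (trans (outStep-inner len G 0 l0) (stepDir-at l0)))
    where
    u = proj₁ (step l0)
    d = oddOffset (classOf (G 0))
  blue⇔blueAt l0 (suc j) p with suc j ℕ.≟ len
  ... | yes refl = blue-via p (0ℤ ℤ.<? cross (dvec x) d)
      (subst (λ z → LeftOf len (suc j) d d₁ d₂ ⇔ (0ℤ ℤ.< cross z d)) (F-step p)
             (leftOf-end len (suc j) d d₁ d₂ (ℕ.s≤s ℕ.z≤n) refl))
      (cong₂ (blueᵇ (classOf (G (suc j)))) (stepDir-at p) (outStep-last len G))
    where
    x = proj₁ (step p)
    d = oddOffset (classOf (G (suc j)))
    d₁ = F (suc j) ⊖ F j
    d₂ = F (suc (suc j)) ⊖ F (suc j)
  ... | no ≢len = blue-via p (leftAtTurn? (dvec x) (dvec u) d)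
      (subst₂ (λ z w → LeftOf len (suc j) d d₁ d₂ ⇔ LeftAtTurn z w d) (F-step p) (F-step p')
              (leftOf-inner len (suc j) d d₁ d₂ (ℕ.s≤s ℕ.z≤n) p'))
      (cong₂ (blueᵇ (classOf (G (suc j)))) (stepDir-at p) (trans (outStep-inner len G (suc j) p') (stepDir-at p')))
    where
    p' : suc j ℕ.< len
    p' = ℕP.≤∧≢⇒< p ≢len
    x = proj₁ (step p)
    u = proj₁ (step p')
    d = oddOffset (classOf (G (suc j)))
    d₁ = F (suc j) ⊖ F j
    d₂ = F (suc (suc j)) ⊖ F (suc j)

reflections-agree : ∀ {X Y : Set} b₁ b₂ → ¬ ¬ ((X → Y) × (Y → X)) → X ⇔ T b₁ → Y ⇔ T b₂ → b₁ ≡ b₂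
reflections-agree false false _ _ _ = refl
reflections-agree true true _ _ _ = refl
reflections-agree true false ¬¬X⇔Y X⇔b₁ Y⇔b₂ =
  ⊥-elim (¬¬X⇔Y (λ (X→Y , _) → Equivalence.to Y⇔b₂ (X→Y (Equivalence.from X⇔b₁ _))))
reflections-agree false true ¬¬X⇔Y X⇔b₁ Y⇔b₂ =
  ⊥-elim (¬¬X⇔Y (λ (_ , Y→X) → Equivalence.to X⇔b₁ (Y→X (Equivalence.from Y⇔b₂ _))))

n≢suc[k+n] : ∀ i k → i ≢ suc (k ℕ.+ i)
n≢suc[k+n] zero k ()
n≢suc[k+n] (suc i) k e = n≢suc[k+n] i k (trans (ℕP.suc-injective e) (ℕP.+-suc k i))

module PathColours {n : ℕ} {I : Pt → Set} {len : ℕ} {F : ℕ → Pt} (sp : SpanningPath n I len F) where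
  open PathSteps sp
  open Equivalence

  colour-uniform : 0 ℕ.< len → NoAlternation n len F → UniformColour (blueAt len G 0) len G
  colour-uniform l0 na = go
    where
    go : ∀ i → i ℕ.≤ len → blueAt len G i ≡ blueAt len G 0
    go zero _ = refl
    go (suc i) p = trans (sym (reflections-agree (blueAt len G i) (blueAt len G (suc i)) (na i p)
                     (blue⇔blueAt l0 i (ℕP.<⇒≤ p)) (blue⇔blueAt l0 (suc i) p))) (go i (ℕP.<⇒≤ p))

  no-alternation : ∀ s → UniformColour s len G → ∀ i → i ℕ.< len → ¬ AltAt n len F i
  no-alternation s uc i p alt = alt (forward , backward)
    where
    l0 : 0 ℕ.< len
    l0 = ℕP.≤-<-trans ℕ.z≤n p
    same : blueAt len G i ≡ blueAt len G (suc i)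
    same = trans (uc i (ℕP.<⇒≤ p)) (sym (uc (suc i) p))
    forward : Blue n len F i → Blue n len F (suc i)
    forward b = from (blue⇔blueAt l0 (suc i) p) (subst T same (to (blue⇔blueAt l0 i (ℕP.<⇒≤ p)) b))
    backward : Blue n len F (suc i) → Blue n len F i
    backward b = from (blue⇔blueAt l0 i (ℕP.<⇒≤ p)) (subst T (sym same) (to (blue⇔blueAt l0 (suc i) p) b))

  no-backtrack : ∀ {i} (p : i ℕ.< len) (q : suc i ℕ.< len) → proj₁ (step q) ≢ opp (proj₁ (step p))
  no-backtrack {i} p q e = n≢suc[k+n] i 1 (rotPath-injective (ℕP.<⇒≤ p) q (sym returns))
    where
    returns : G (suc (suc i)) ≡ G i
    returns = trans (proj₂ (step q)) (trans (cong (λ z → G (suc i) ⊕ dirv z) e)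
              (trans (cong (λ z → z ⊕ dirv (opp (proj₁ (step p)))) (proj₂ (step p))) (step-back (G i) (proj₁ (step p)))))

  orientation⇒colour : ∀ s → 0 ℕ.< len → UniformOrientation s len G → UniformColour s len G
  orientation⇒colour s l0 uo zero p =
    trans (cong (blueᵇ (classOf (G 0)) nothing) (trans (outStep-inner len G 0 l0) (stepDir-at l0)))
          (trans (blue-at-start (classOf (G 0)) (proj₁ (step l0))) (trans (sym (manhattanAt-step l0)) (uo 0 l0)))
  orientation⇒colour s l0 uo (suc j) p with suc j ℕ.≟ len
  ... | yes refl =
    trans (cong₂ (blueᵇ (classOf (G (suc j)))) (stepDir-at p) (outStep-last len G))
     (trans (cong (λ c → blueᵇ c (just (proj₁ (step p))) nothing) (classOf-next p))
       (trans (blue-at-end (classOf (G j)) (proj₁ (step p))) (trans (sym (manhattanAt-step p)) (uo j p))))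
  ... | no ≢len =
    trans (cong₂ (blueᵇ (classOf (G (suc j)))) (stepDir-at p) (trans (outStep-inner len G (suc j) p') (stepDir-at p')))
     (trans (cong (λ c → blueᵇ c (just (proj₁ (step p))) (just (proj₁ (step p')))) (classOf-next p))
       (trans (blue-interior (classOf (G j)) (proj₁ (step p)) (proj₁ (step p'))
                 (trans oriented-out (sym oriented-in)) (no-backtrack p p'))
              oriented-in))
    where
    p' : suc j ℕ.< len
    p' = ℕP.≤∧≢⇒< p ≢len
    oriented-in : manhattanᵇ (classOf (G j)) (proj₁ (step p)) ≡ s
    oriented-in = trans (sym (manhattanAt-step p)) (uo j p)
    oriented-out : manhattanᵇ (classAfter (classOf (G j)) (proj₁ (step p))) (proj₁ (step p')) ≡ s
    oriented-out = trans (cong (λ c → manhattanᵇ c (proj₁ (step p'))) (sym (classOf-next p)))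
                         (trans (sym (manhattanAt-step p')) (uo (suc j) p'))

-- Excision: skip a d renumbers the vertices of a path after deleting the d
-- vertices following vertex a.
skip : ℕ → ℕ → ℕ → ℕ
skip a d j = if j ≤ᵇ a then j else j ℕ.+ d

skip-below : ∀ a d j → j ℕ.≤ a → skip a d j ≡ j
skip-below a d j p rewrite Equivalence.to BP.T-≡ (ℕP.≤⇒≤ᵇ p) = refl

skip-above : ∀ a d j → a ℕ.< j → skip a d j ≡ j ℕ.+ d
skip-above a d j p with j ≤ᵇ a in e
... | false = refl
... | true = ⊥-elim (ℕP.<⇒≱ p (ℕP.≤ᵇ⇒≤ j a (subst T (sym e) _)))

skip-suc : ∀ a d j → ¬ j ≡ a → skip a d (suc j) ≡ suc (skip a d j)
skip-suc a d j ne with ℕP.<-cmp j a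
... | tri< lt _ _ = trans (skip-below a d (suc j) lt) (cong suc (sym (skip-below a d j (ℕP.<⇒≤ lt))))
... | tri≈ _ eq _ = ⊥-elim (ne eq)
... | tri> _ _ gt = trans (skip-above a d (suc j) (ℕP.<-trans gt (ℕP.n<1+n j))) (cong suc (sym (skip-above a d j gt)))

≡ᵇ-cong : ∀ {i j k l} → (i ≡ j → k ≡ l) → (k ≡ l → i ≡ j) → (i ℕ.≡ᵇ j) ≡ (k ℕ.≡ᵇ l)
≡ᵇ-cong {i} {j} {k} {l} f g with i ℕ.≡ᵇ j in e1 | k ℕ.≡ᵇ l in e2
... | false | false = refl
... | true | true = refl
... | true | false = ⊥-elim (subst T e2 (ℕP.≡⇒≡ᵇ k l (f (ℕP.≡ᵇ⇒≡ i j (subst T (sym e1) _)))))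
... | false | true = ⊥-elim (subst T e1 (ℕP.≡⇒≡ᵇ i j (g (ℕP.≡ᵇ⇒≡ k l (subst T (sym e2) _)))))

module Excise {n : ℕ} {I : Pt → Set} {len : ℕ} {F : ℕ → Pt} (sp : SpanningPath n I len F)
           (a d : ℕ) (a+d<len : a ℕ.+ d ℕ.< len) where

  len' : ℕ
  len' = len ℕ.∸ d

  F' : ℕ → Pt
  F' j = F (skip a d j)

  d≤len : d ℕ.≤ len
  d≤len = ℕP.≤-trans (ℕP.m≤n+m d a) (ℕP.<⇒≤ a+d<len)

  a<len' : a ℕ.< len'
  a<len' = ℕP.m+n≤o⇒m≤o∸n (suc a) a+d<len

  skip-bound : ∀ {j} → j ℕ.≤ len' → skip a d j ℕ.≤ len
  skip-bound {j} p with j ℕ.≤? a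
  ... | yes q = subst (ℕ._≤ len) (sym (skip-below a d j q)) (ℕP.≤-trans q (ℕP.≤-trans (ℕP.m≤m+n a d) (ℕP.<⇒≤ a+d<len)))
  ... | no q = subst (ℕ._≤ len) (sym (skip-above a d j (ℕP.≰⇒> q))) (ℕP.m≤o∸n⇒m+n≤o j d≤len p)

  skip-injective : ∀ {i j} → skip a d i ≡ skip a d j → i ≡ j
  skip-injective {i} {j} e with i ℕ.≤? a | j ℕ.≤? a
  ... | yes p | yes q = trans (sym (skip-below a d i p)) (trans e (skip-below a d j q))
  ... | no p | no q = ℕP.+-cancelʳ-≡ d i j (trans (sym (skip-above a d i (ℕP.≰⇒> p))) (trans e (skip-above a d j (ℕP.≰⇒> q))))
  ... | yes p | no q = ⊥-elim (ℕP.<⇒≱ (ℕP.≤-trans (ℕP.≰⇒> q) (ℕP.m≤m+n j d))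
          (subst (ℕ._≤ a) (trans (sym (skip-below a d i p)) (trans e (skip-above a d j (ℕP.≰⇒> q)))) p))
  ... | no p | yes q = ⊥-elim (ℕP.<⇒≱ (ℕP.≤-trans (ℕP.≰⇒> p) (ℕP.m≤m+n i d))
          (subst (ℕ._≤ a) (trans (sym (skip-below a d j q)) (trans (sym e) (skip-above a d i (ℕP.≰⇒> p)))) q))

  excised-spanning : DAdj n (F a) (F (suc a ℕ.+ d)) → SpanningPath n I len' F'
  excised-spanning nd = (λ j p → proj₁ sp (skip a d j) (skip-bound p)) , adj , inj , bnd
    where
    adj : ∀ j → j ℕ.< len' → DAdj n (F' j) (F' (suc j))
    adj j p with ℕP.<-cmp j a
    ... | tri< lt _ _ = subst₂ (λ x y → DAdj n (F x) (F y)) (sym (skip-below a d j (ℕP.<⇒≤ lt))) (sym (skip-below a d (suc j) lt))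
                          (proj₁ (proj₂ sp) j (ℕP.<-trans lt (ℕP.≤-<-trans (ℕP.m≤m+n a d) a+d<len)))
    ... | tri≈ _ refl _ = subst₂ (λ x y → DAdj n (F x) (F y)) (sym (skip-below a d j ℕP.≤-refl)) (sym (skip-above a d (suc j) (ℕP.n<1+n j))) nd
    ... | tri> _ _ gt = subst₂ (λ x y → DAdj n (F x) (F y)) (sym (skip-above a d j gt)) (sym (skip-above a d (suc j) (ℕP.<-trans gt (ℕP.n<1+n j))))
                          (proj₁ (proj₂ sp) (j ℕ.+ d) (ℕP.m≤o∸n⇒m+n≤o (suc j) d≤len p))
    inj : ∀ i j → i ℕ.≤ len' → j ℕ.≤ len' → F' i ≡ F' j → i ≡ j
    inj i j p q e = skip-injective (proj₁ (proj₂ (proj₂ sp)) (skip a d i) (skip a d j) (skip-bound p) (skip-bound q) e)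
    e0 : F' 0 ≡ F 0
    e0 = cong F (skip-below a d 0 ℕ.z≤n)
    eL : F' len' ≡ F len
    eL = cong F (trans (skip-above a d len' a<len') (ℕP.m∸n+n≡m d≤len))
    bnd : (TopB n (F' 0) × BottomB n (F' len')) ⊎ (LeftB n (F' 0) × RightB n (F' len'))
    bnd with proj₂ (proj₂ (proj₂ sp))
    ... | inj₁ (t , b) = inj₁ (subst (TopB n) (sym e0) t , subst (BottomB n) (sym eL) b)
    ... | inj₂ (l , r) = inj₂ (subst (LeftB n) (sym e0) l , subst (RightB n) (sym eL) r)

  G' : ℕ → Pt
  G' = rotPath F'

  inStep-excised : ∀ j → ¬ j ≡ suc a → inStep G' j ≡ inStep (rotPath F) (skip a d j)
  inStep-excised zero _ = cong (inStep (rotPath F)) (sym (skip-below a d 0 ℕ.z≤n))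
  inStep-excised (suc j) ne = trans (cong (λ z → stepDir (rot (F (skip a d j))) (rot (F z))) (skip-suc a d j (λ e → ne (cong suc e))))
                             (cong (inStep (rotPath F)) (sym (skip-suc a d j (λ e → ne (cong suc e)))))

  outStep-excised : ∀ j → ¬ j ≡ a → outStep len' G' j ≡ outStep len (rotPath F) (skip a d j)
  outStep-excised j ne = cong₂ (λ b z → if b then nothing else z) (≡ᵇ-cong f g)
                    (cong (λ z → stepDir (rot (F (skip a d j))) (rot (F z))) (skip-suc a d j ne))
    where
    f : j ≡ len' → skip a d j ≡ len
    f refl = trans (skip-above a d len' a<len') (ℕP.m∸n+n≡m d≤len)
    g : skip a d j ≡ len → j ≡ len'
    g e with j ℕ.≤? a
    ... | yes q = ⊥-elim (ℕP.<⇒≱ (ℕP.≤-<-trans q (ℕP.≤-<-trans (ℕP.m≤m+n a d) a+d<len)) (ℕP.≤-reflexive (trans (sym e) (skip-below a d j q))))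
    ... | no q = trans (sym (ℕP.m+n∸n≡m j d)) (cong (ℕ._∸ d) (trans (sym (skip-above a d j (ℕP.≰⇒> q))) e))

  manhattanAt-excised : ∀ j → ¬ j ≡ a → manhattanAt G' j ≡ manhattanAt (rotPath F) (skip a d j)
  manhattanAt-excised j ne = cong (λ z → manhattanStepᵇ (classOf (rot (F (skip a d j)))) (stepDir (rot (F (skip a d j))) (rot (F z)))) (skip-suc a d j ne)

  blueAt-excised : ∀ j → ¬ j ≡ a → ¬ j ≡ suc a → blueAt len' G' j ≡ blueAt len (rotPath F) (skip a d j)
  blueAt-excised j n1 n2 = cong₂ (blueᵇ (classOf (G' j))) (inStep-excised j n2) (outStep-excised j n1)

nothing≢just : ∀ {x : Dir} → ¬ (nothing ≡ just x)
nothing≢just ()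

module PathStepFacts {n : ℕ} {I : Pt → Set} {len : ℕ} {F : ℕ → Pt} (sp : SpanningPath n I len F) where
  open PathSteps sp
  open PathColours sp

  stepAt : ∀ {i} → i ℕ.< len → Dir
  stepAt p = proj₁ (step p)

  inStep≢opp : ∀ k (pk : k ℕ.< len) → ¬ inStep G k ≡ just (opp (stepAt pk))
  inStep≢opp zero pk e = nothing≢just e
  inStep≢opp (suc k) pk e = no-backtrack q pk (trans (sym (opp-opp (stepAt pk))) (cong opp (sym (MaybeP.just-injective (trans (sym (stepDir-at q)) e)))))
    where
    q : k ℕ.< len
    q = ℕP.<-trans (ℕP.n<1+n k) pk

  outStep≢opp : ∀ k (pk : k ℕ.< len) → ¬ outStep len G (suc k) ≡ just (opp (stepAt pk))
  outStep≢opp k pk e with suc k ℕ.≟ len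
  ... | yes eq = nothing≢just (trans (sym (outStep-last len G)) (trans (cong (λ z → outStep len G z) (sym eq)) e))
  ... | no ne = no-backtrack pk q (MaybeP.just-injective (trans (sym (stepDir-at q)) (trans (sym (outStep-inner len G (suc k) q)) e)))
    where
    q : suc k ℕ.< len
    q = ℕP.≤∧≢⇒< pk ne

  inStep-just : ∀ k → k ℕ.≤ len → ∀ {x} → inStep G k ≡ just x → Σ ℕ (λ k₀ → Σ (k₀ ℕ.< len) (λ q → k ≡ suc k₀ × stepAt q ≡ x))
  inStep-just zero _ e = ⊥-elim (nothing≢just e)
  inStep-just (suc k) pk e = k , pk , refl , MaybeP.just-injective (trans (sym (stepDir-at pk)) e)

  outStep-just : ∀ k → k ℕ.≤ len → ∀ {y} → outStep len G k ≡ just y → Σ (k ℕ.< len) (λ q → stepAt q ≡ y)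
  outStep-just k pk {y} e with k ℕ.≟ len
  ... | yes refl = ⊥-elim (nothing≢just (trans (sym (outStep-last len G)) e))
  ... | no ne = q , MaybeP.just-injective (trans (sym (stepDir-at q)) (trans (sym (outStep-inner len G k q)) e))
    where
    q : k ℕ.< len
    q = ℕP.≤∧≢⇒< pk ne

module UTurn {n : ℕ} {I : Pt → Set} {len : ℕ} {F : ℕ → Pt} (sp : SpanningPath n I len F)
   (a : ℕ) (x u : Dir) (p₀ : a ℕ.< len) (p₁ : suc a ℕ.< len) (p₂ : suc (suc a) ℕ.< len)
   (step₀ : PathStepFacts.stepAt sp p₀ ≡ x) (step₁ : PathStepFacts.stepAt sp p₁ ≡ u)
   (step₂ : PathStepFacts.stepAt sp p₂ ≡ opp x) where
  open PathSteps sp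
  open PathColours sp
  open PathStepFacts sp

  a2 a3 : ℕ
  a2 = suc (suc a)
  a3 = suc a2

  G₁ : G (suc a) ≡ G a ⊕ dirv x
  G₁ = trans (proj₂ (step p₀)) (cong (λ z → G a ⊕ dirv z) step₀)
  G₂ : G a2 ≡ G (suc a) ⊕ dirv u
  G₂ = trans (proj₂ (step p₁)) (cong (λ z → G (suc a) ⊕ dirv z) step₁)
  G₃ : G a3 ≡ G a2 ⊕ dirv (opp x)
  G₃ = trans (proj₂ (step p₂)) (cong (λ z → G a2 ⊕ dirv z) step₂)
  G₃≡G₀⊕u : G a3 ≡ G a ⊕ dirv u
  G₃≡G₀⊕u = trans G₃ (trans (cong (_⊕ dirv (opp x)) (trans G₂ (cong (_⊕ dirv u) G₁)))
                            (uturn-displacement (G a) x (dirv u)))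

  c0 : Class
  c0 = classOf (G a)
  class₁≡ : classOf (G (suc a)) ≡ class₁ c0 x u
  class₁≡ = trans (cong classOf G₁) (classOf-step (G a) x)
  class₂≡ : classOf (G a2) ≡ class₂ c0 x u
  class₂≡ = trans (cong classOf G₂) (trans (classOf-step (G (suc a)) u) (cong (λ c → classAfter c u) class₁≡))
  class₃≡ : classOf (G a3) ≡ class₃ c0 x u
  class₃≡ = trans (cong classOf G₃) (trans (classOf-step (G a2) (opp x)) (cong (λ c → classAfter c (opp x)) class₂≡))

  dir₀ : stepDir (G a) (G (suc a)) ≡ just x
  dir₀ = trans (stepDir-at p₀) (cong just step₀)
  dir₁ : stepDir (G (suc a)) (G a2) ≡ just u
  dir₁ = trans (stepDir-at p₁) (cong just step₁)
  dir₂ : stepDir (G a2) (G a3) ≡ just (opp x)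
  dir₂ = trans (stepDir-at p₂) (cong just step₂)

  u≢opp-x : u ≢ opp x
  u≢opp-x e = no-backtrack p₀ p₁ (trans step₁ (trans e (cong opp (sym step₀))))
  u≢x : u ≢ x
  u≢x e = no-backtrack p₁ p₂ (trans step₂ (cong opp (trans (sym e) (sym step₁))))

module UTurnShortcut {n : ℕ} {I : Pt → Set} {len : ℕ} {F : ℕ → Pt} (sp : SpanningPath n I len F)
   (a : ℕ) (x u : Dir) (p₀ : a ℕ.< len) (p₁ : suc a ℕ.< len) (p₂ : suc (suc a) ℕ.< len)
   (step₀ : PathStepFacts.stepAt sp p₀ ≡ x) (step₁ : PathStepFacts.stepAt sp p₁ ≡ u)
   (step₂ : PathStepFacts.stepAt sp p₂ ≡ opp x) where
  open PathSteps sp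
  open UTurn sp a x u p₀ p₁ p₂ step₀ step₁ step₂

  a+2≡a₂ : a ℕ.+ 2 ≡ a2
  a+2≡a₂ = ℕP.+-comm a 2
  a+2<len : a ℕ.+ 2 ℕ.< len
  a+2<len = subst (ℕ._< len) (sym a+2≡a₂) p₂

  open Excise sp a 2 a+2<len public

  spanning : SpanningPath n I len' F'
  spanning = excised-spanning
    (subst (λ k → DAdj n (F a) (F (suc k))) (sym a+2≡a₂) (rot-step⇒dadj u (ℕP.<⇒≤ p₀) p₂ G₃≡G₀⊕u))

  skip-a : skip a 2 a ≡ a
  skip-a = skip-below a 2 a ℕP.≤-refl
  skip-a+1 : skip a 2 (suc a) ≡ a3
  skip-a+1 = trans (skip-above a 2 (suc a) (ℕP.n<1+n a)) (cong suc a+2≡a₂)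

  dir-new : stepDir (G' a) (G' (suc a)) ≡ just u
  dir-new = trans (cong₂ (λ k l → stepDir (rot (F k)) (rot (F l))) skip-a skip-a+1)
                  (trans (cong (stepDir (G a)) G₃≡G₀⊕u) (stepDir-⊕ (G a) u))

module ColourShortcut {n : ℕ} {I : Pt → Set} {len : ℕ} {F : ℕ → Pt} (sp : SpanningPath n I len F)
   (s : Bool) (uc : UniformColour s len (rotPath F)) (a : ℕ) (x u : Dir)
   (p₀ : a ℕ.< len) (p₁ : suc a ℕ.< len) (p₂ : suc (suc a) ℕ.< len)
   (step₀ : PathStepFacts.stepAt sp p₀ ≡ x) (step₁ : PathStepFacts.stepAt sp p₁ ≡ u)
   (step₂ : PathStepFacts.stepAt sp p₂ ≡ opp x)
   (misoriented : manhattanᵇ (classOf (rotPath F (suc a))) u ≢ s) where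
  open PathSteps sp
  open PathColours sp
  open PathStepFacts sp
  open UTurn sp a x u p₀ p₁ p₂ step₀ step₁ step₂
  open UTurnShortcut sp a x u p₀ p₁ p₂ step₀ step₁ step₂

  w z : Maybe Dir
  w = inStep G a
  z = outStep len G a3

  colour₀ : blueᵇ c0 w (just x) ≡ s
  colour₀ = trans (cong (blueᵇ c0 w) (sym (trans (outStep-inner len G a p₀) dir₀))) (uc a (ℕP.<⇒≤ p₀))
  colour₁ : blueᵇ (class₁ c0 x u) (just x) (just u) ≡ s
  colour₁ = trans (sym (cong₃ blueᵇ class₁≡ dir₀ (trans (outStep-inner len G (suc a) p₁) dir₁))) (uc (suc a) (ℕP.<⇒≤ p₁))
  colour₂ : blueᵇ (class₂ c0 x u) (just u) (just (opp x)) ≡ s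
  colour₂ = trans (sym (cong₃ blueᵇ class₂≡ dir₁ (trans (outStep-inner len G a2 p₂) dir₂))) (uc a2 (ℕP.<⇒≤ p₂))
  colour₃ : blueᵇ (class₃ c0 x u) (just (opp x)) z ≡ s
  colour₃ = trans (sym (cong₂ (λ c m → blueᵇ c m z) class₃≡ dir₂)) (uc a3 p₂)

  w≢opp-u : w ≢ just (opp u)
  w≢opp-u e with inStep-just a (ℕP.<⇒≤ p₀) e
  ... | b , pb , refl , stepb = n≢suc[k+n] b 3 (rotPath-injective (ℕP.<⇒≤ pb) p₂
          (sym (trans G₃≡G₀⊕u (trans (cong (_⊕ dirv u) (trans (proj₂ (step pb)) (cong (λ z → G b ⊕ dirv z) stepb)))
                                     (step-back' (G b) u)))))
  z≢opp-u : z ≢ just (opp u)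
  z≢opp-u e with outStep-just a3 p₂ e
  ... | p₃ , step₃ = n≢suc[k+n] a 3 (rotPath-injective (ℕP.<⇒≤ p₀) p₃
          (sym (trans (proj₂ (step p₃)) (trans (cong₂ (λ p v → p ⊕ dirv v) G₃≡G₀⊕u step₃) (step-back (G a) u)))))
  w≢opp-x : w ≢ just (opp x)
  w≢opp-x e with inStep-just a (ℕP.<⇒≤ p₀) e
  ... | b , pb , refl , stepb = no-backtrack pb p₀ (trans step₀ (trans (sym (opp-opp x)) (cong opp (sym stepb))))
  z≢x : z ≢ just x
  z≢x e with outStep-just a3 p₂ e
  ... | p₃ , step₃ = no-backtrack p₂ p₃ (trans step₃ (trans (sym (opp-opp x)) (cong opp (sym step₂))))

  new-colours : blueᵇ c0 w (just u) ≡ s × blueᵇ (class₃ c0 x u) (just u) z ≡ s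
  new-colours = shortcut-keeps-colours s c0 w x u z colour₀ colour₁ colour₂ colour₃
    (λ e → misoriented (trans (cong (λ c → manhattanᵇ c u) class₁≡) e))
    w≢opp-u z≢opp-u w≢opp-x z≢x u≢opp-x u≢x

  a≢suc-a : a ≢ suc a
  a≢suc-a e = ℕP.<-irrefl e (ℕP.n<1+n a)

  colours : UniformColour s len' G'
  colours j pj with j ℕ.≟ a | j ℕ.≟ suc a
  ... | yes refl | _ =
    trans (cong₂ (λ c m → blueᵇ c m (outStep len' G' j)) (cong (λ k → classOf (rot (F k))) skip-a)
             (trans (inStep-excised j a≢suc-a) (cong (inStep G) skip-a)))
      (trans (cong (blueᵇ c0 w) (trans (outStep-inner len' G' j a<len') dir-new)) (proj₁ new-colours))
  ... | no j≢a | yes refl =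
    trans (cong₂ (λ c m → blueᵇ c m (outStep len' G' j)) (trans (cong (λ k → classOf (rot (F k))) skip-a+1) class₃≡) dir-new)
      (trans (cong (blueᵇ (class₃ c0 x u) (just u)) (trans (outStep-excised j j≢a) (cong (outStep len G) skip-a+1)))
             (proj₂ new-colours))
  ... | no j≢a | no j≢a+1 = trans (blueAt-excised j j≢a j≢a+1) (uc (skip a 2 j) (skip-bound pj))

maxCoord : ℕ → ℤ
maxCoord n = + (2 ℕ.* (n ℕ.∸ 1))

no-succ-≤ : ∀ x → ¬ (x + 1ℤ ℤ.≤ x)
no-succ-≤ x h = ℤP.<-irrefl refl (ℤP.suc[i]≤j⇒i<j (subst (ℤ._≤ x) (ℤP.+-comm x 1ℤ) h))

pred-≤ : ∀ x → x + -1ℤ ℤ.≤ x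
pred-≤ x = ℤP.≤-trans (ℤP.+-monoʳ-≤ x (ℤ.-≤+)) (ℤP.≤-reflexive (ℤP.+-identityʳ x))

gridVertex-bounds : ∀ {n p} → GVert n p → (0ℤ ℤ.≤ proj₁ p × proj₁ p ℤ.≤ maxCoord n) × (0ℤ ℤ.≤ proj₂ p × proj₂ p ℤ.≤ maxCoord n)
gridVertex-bounds {n} (i , j , pi , pj , refl) = (ℤ.+≤+ ℕ.z≤n , ℤ.+≤+ (ℕP.*-monoʳ-≤ 2 (≤pred pi))) , (ℤ.+≤+ ℕ.z≤n , ℤ.+≤+ (ℕP.*-monoʳ-≤ 2 (≤pred pj)))
  where
  ≤pred : ∀ {i n} → i ℕ.< n → i ℕ.≤ n ℕ.∸ 1
  ≤pred {i} {suc n} (ℕ.s≤s p) = p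

between-endpoints : ∀ M x c → (c ≡ 0ℤ ⊎ c ≡ 1ℤ ⊎ c ≡ -1ℤ) → (0ℤ ℤ.≤ x - c × x - c ℤ.≤ M) → (0ℤ ℤ.≤ x + c × x + c ℤ.≤ M) →
     0ℤ ℤ.≤ x × x ℤ.≤ M
between-endpoints M x _ (inj₁ refl) (l , _) (_ , u) = subst (0ℤ ℤ.≤_) (ℤP.+-identityʳ x) l , subst (ℤ._≤ M) (ℤP.+-identityʳ x) u
between-endpoints M x _ (inj₂ (inj₁ refl)) (l , _) (_ , u) = ℤP.≤-trans l (pred-≤ x) , ℤP.≤-trans (ℤP.i≤i+j x 1ℤ) u
between-endpoints M x _ (inj₂ (inj₂ refl)) (_ , u) (l , _) = ℤP.≤-trans l (pred-≤ x) , ℤP.≤-trans (ℤP.i≤i+j x 1ℤ) u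

axis-x-small : ∀ t → proj₁ (axv t) ≡ 0ℤ ⊎ proj₁ (axv t) ≡ 1ℤ ⊎ proj₁ (axv t) ≡ -1ℤ
axis-x-small E = inj₂ (inj₁ refl)
axis-x-small W = inj₂ (inj₂ refl)
axis-x-small N = inj₁ refl
axis-x-small S = inj₁ refl

axis-y-small : ∀ t → proj₂ (axv t) ≡ 0ℤ ⊎ proj₂ (axv t) ≡ 1ℤ ⊎ proj₂ (axv t) ≡ -1ℤ
axis-y-small E = inj₁ refl
axis-y-small W = inj₁ refl
axis-y-small N = inj₂ (inj₁ refl)
axis-y-small S = inj₂ (inj₂ refl)

mid-bounds : ∀ {n m} → Mid n m → (0ℤ ℤ.≤ proj₁ m × proj₁ m ℤ.≤ maxCoord n) × (0ℤ ℤ.≤ proj₂ m × proj₂ m ℤ.≤ maxCoord n)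
mid-bounds {n} {x , y} (e , ue , gA , gB) with toAx ue
... | t , refl = between-endpoints (maxCoord n) x _ (axis-x-small t) (proj₁ (gridVertex-bounds gA)) (proj₁ (gridVertex-bounds gB)) ,
                 between-endpoints (maxCoord n) y _ (axis-y-small t) (proj₂ (gridVertex-bounds gA)) (proj₂ (gridVertex-bounds gB))

⊕-assoc5 : ∀ g a b c d e → ((((g ⊕ a) ⊕ b) ⊕ c) ⊕ d) ⊕ e ≡ g ⊕ ((((a ⊕ b) ⊕ c) ⊕ d) ⊕ e)
⊕-assoc5 (g1 , g2) (a1 , a2) (b1 , b2) (c1 , c2) (d1 , d2) (e1 , e2) = ≡pt (r g1 a1 b1 c1 d1 e1) (r g2 a2 b2 c2 d2 e2)
  where
  r : ∀ g a b c d e → g + a + b + c + d + e ≡ g + (a + b + c + d + e)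
  r = solve-∀

uturnIndex : ℕ → UTurnVertex → ℕ
uturnIndex a t0 = a
uturnIndex a t1 = suc a
uturnIndex a t2 = suc (suc a)
uturnIndex a t3 = suc (suc (suc a))

no-neg-succ : ∀ y → 0ℤ ℤ.≤ y → y + 1ℤ ≡ 0ℤ → ⊥
no-neg-succ y p e with subst (λ z → 0ℤ + 1ℤ ℤ.≤ z) e (ℤP.+-monoˡ-≤ 1ℤ p)
... | ℤ.+≤+ ()

-- Its three steps are
-- s-oriented, so by uturn-crosses-line it can neither start at the first
-- vertex nor end at the last vertex of a spanning path: some vertex of it
-- would lie beyond the boundary line through that vertex.
module OrientedUTurn {n : ℕ} {I : Pt → Set} {len : ℕ} {F : ℕ → Pt} (sp : SpanningPath n I len F)
   (s : Bool) (uo : UniformOrientation s len (rotPath F))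
   (a : ℕ) (x u : Dir) (p₀ : a ℕ.< len) (p₁ : suc a ℕ.< len) (p₂ : suc (suc a) ℕ.< len)
   (step₀ : PathStepFacts.stepAt sp p₀ ≡ x) (step₁ : PathStepFacts.stepAt sp p₁ ≡ u)
   (step₂ : PathStepFacts.stepAt sp p₂ ≡ opp x) where
  open PathSteps sp
  open UTurn sp a x u p₀ p₁ p₂ step₀ step₁ step₂

  oriented₀ : manhattanᵇ c0 x ≡ s
  oriented₀ = trans (sym (trans (manhattanAt-step p₀) (cong (manhattanᵇ c0) step₀))) (uo a p₀)
  oriented₁ : manhattanᵇ (class₁ c0 x u) u ≡ s
  oriented₁ = trans (sym (trans (manhattanAt-step p₁) (cong₂ manhattanᵇ class₁≡ step₁))) (uo (suc a) p₁)
  oriented₂ : manhattanᵇ (class₂ c0 x u) (opp x) ≡ s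
  oriented₂ = trans (sym (trans (manhattanAt-step p₂) (cong₂ manhattanᵇ class₂≡ step₂))) (uo a2 p₂)

  crossing : Crossings c0 (class₃ c0 x u) x u
  crossing = uturn-crosses-line s c0 x u oriented₀ oriented₁ oriented₂ u≢x u≢opp-x

  vertex-G : ∀ t → G (uturnIndex a t) ≡ G a ⊕ uturnOffset x u t
  vertex-G t0 = sym (⊕-identityʳ (G a))
  vertex-G t1 = G₁
  vertex-G t2 = trans G₂ (trans (cong (_⊕ dirv u) G₁) (⊕-assoc (G a) (dirv x) (dirv u)))
  vertex-G t3 = trans G₃ (trans (cong (_⊕ dirv (opp x)) (vertex-G t2)) (⊕-assoc (G a) (dirv x ⊕ dirv u) (dirv (opp x))))

  vertex≤len : ∀ t → uturnIndex a t ℕ.≤ len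
  vertex≤len t0 = ℕP.<⇒≤ p₀
  vertex≤len t1 = ℕP.<⇒≤ p₁
  vertex≤len t2 = ℕP.<⇒≤ p₂
  vertex≤len t3 = p₂

  vertex-F : ∀ t → F (uturnIndex a t) ≡ F a ⊕ (Δx (uturnOffset x u t) , Δy (uturnOffset x u t))
  vertex-F t = trans (F≡unrot (vertex≤len t)) (trans (cong unrot (vertex-G t)) (trans (unrot-⊕ (G a) (uturnOffset x u t))
            (cong (_⊕ (Δx (uturnOffset x u t) , Δy (uturnOffset x u t))) (sym (F≡unrot (ℕP.<⇒≤ p₀))))))

  vertex-bounds : ∀ t → let q = F (uturnIndex a t) in
    (0ℤ ℤ.≤ proj₁ q × proj₁ q ℤ.≤ maxCoord n) × (0ℤ ℤ.≤ proj₂ q × proj₂ q ℤ.≤ maxCoord n)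
  vertex-bounds t = mid-bounds {n} {F (uturnIndex a t)} (mid (vertex≤len t))

  F₀≡unrot : F a ≡ unrot (G a)
  F₀≡unrot = F≡unrot (ℕP.<⇒≤ p₀)
  F₃≡unrot : F a3 ≡ unrot (G a3)
  F₃≡unrot = F≡unrot p₂

  not-at-start : a ≢ 0
  not-at-start refl with proj₂ (proj₂ (proj₂ sp))
  ... | inj₁ (top , _) = not-on-top top
    where
    not-on-top : TopB n (F a) → ⊥
    not-on-top top with proj₁ crossing (trans (sym (par-unrot-y (proj₁ (G a)) (proj₂ (G a))))
                          (trans (cong (λ m → par (proj₂ m)) (sym F₀≡unrot)) (trans (cong par top) (parℕ-2* (n ℕ.∸ 1)))))
    ... | t , above = no-succ-≤ (maxCoord n)
          (subst (ℤ._≤ maxCoord n) (trans (cong proj₂ (vertex-F t)) (cong₂ _+_ top above)) (proj₂ (proj₂ (vertex-bounds t))))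
  ... | inj₂ (left , _) = not-on-left left
    where
    not-on-left : LeftB n (F a) → ⊥
    not-on-left left with proj₁ (proj₂ crossing) (trans (sym (BP.not-involutive _))
                            (cong not (trans (sym (par-unrot-x (proj₁ (G a)) (proj₂ (G a))))
                                             (trans (cong (λ m → par (proj₁ m)) (sym F₀≡unrot)) (cong par left)))))
    ... | t , beyond with subst (0ℤ ℤ.≤_) (trans (cong proj₁ (vertex-F t)) (cong₂ _+_ left beyond)) (proj₁ (proj₁ (vertex-bounds t)))
    ...   | ()

  not-at-end : a3 ≢ len
  not-at-end a3≡len with proj₂ (proj₂ (proj₂ sp))
  ... | inj₁ (_ , bottom) = no-neg-succ (proj₂ (F (uturnIndex a t))) (proj₁ (proj₂ (vertex-bounds t))) below
    where
    bottom₃ : proj₂ (F a3) ≡ 0ℤ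
    bottom₃ = subst (λ k → proj₂ (F k) ≡ 0ℤ) (sym a3≡len) bottom
    parity : yParity (class₃ c0 x u) ≡ false
    parity = trans (sym (cong yParity class₃≡)) (trans (sym (par-unrot-y (proj₁ (G a3)) (proj₂ (G a3))))
           (trans (cong (λ m → par (proj₂ m)) (sym F₃≡unrot)) (cong par bottom₃)))
    t = proj₁ (proj₁ (proj₂ (proj₂ crossing)) parity)
    below : proj₂ (F (uturnIndex a t)) + 1ℤ ≡ 0ℤ
    below = trans (cong (_+ 1ℤ) (cong proj₂ (vertex-F t))) (trans (ℤP.+-assoc (proj₂ (F a)) _ 1ℤ)
           (trans (cong (λ z → proj₂ (F a) + z) (proj₂ (proj₁ (proj₂ (proj₂ crossing)) parity)))
                  (trans (sym (cong proj₂ (vertex-F t3))) bottom₃)))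
  ... | inj₂ (_ , right) = no-succ-≤ (maxCoord n) (subst (ℤ._≤ maxCoord n) beyond (proj₂ (proj₁ (vertex-bounds t))))
    where
    right₃ : proj₁ (F a3) ≡ maxCoord n
    right₃ = subst (λ k → proj₁ (F k) ≡ maxCoord n) (sym a3≡len) right
    parity : yParity (class₃ c0 x u) ≡ true
    parity = trans (sym (cong yParity class₃≡)) (trans (sym (BP.not-involutive _))
           (cong not (trans (sym (par-unrot-x (proj₁ (G a3)) (proj₂ (G a3))))
                   (trans (cong (λ m → par (proj₁ m)) (sym F₃≡unrot)) (trans (cong par right₃) (parℕ-2* (n ℕ.∸ 1)))))))
    t = proj₁ (proj₂ (proj₂ (proj₂ crossing)) parity)
    beyond : proj₁ (F (uturnIndex a t)) ≡ maxCoord n + 1ℤ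
    beyond = trans (cong proj₁ (vertex-F t)) (trans (cong (λ z → proj₁ (F a) + z) (proj₂ (proj₂ (proj₂ (proj₂ crossing)) parity)))
           (trans (sym (ℤP.+-assoc (proj₁ (F a)) _ 1ℤ)) (cong (_+ 1ℤ) (trans (sym (cong proj₁ (vertex-F t3))) right₃))))

module UTurnBypass {n : ℕ} {I : Pt → Set} {len : ℕ} {F : ℕ → Pt} (sp : SpanningPath n I len F)
   (s : Bool) (uo : UniformOrientation s len (rotPath F)) (b : ℕ) (x u : Dir)
   (p₀ : suc b ℕ.< len) (p₁ : suc (suc b) ℕ.< len) (p₂ : suc (suc (suc b)) ℕ.< len)
   (step₀ : PathStepFacts.stepAt sp p₀ ≡ x) (step₁ : PathStepFacts.stepAt sp p₁ ≡ u)
   (step₂ : PathStepFacts.stepAt sp p₂ ≡ opp x) (p₃ : suc (suc (suc (suc b))) ℕ.< len) where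
  open PathSteps sp
  open PathColours sp
  open PathStepFacts sp
  open UTurn sp (suc b) x u p₀ p₁ p₂ step₀ step₁ step₂
  open OrientedUTurn sp s uo (suc b) x u p₀ p₁ p₂ step₀ step₁ step₂

  pb : b ℕ.< len
  pb = ℕP.<-trans (ℕP.n<1+n b) p₀
  w z : Dir
  w = stepAt pb
  z = stepAt p₃
  a4 : ℕ
  a4 = suc a3

  Gb : G (suc b) ≡ G b ⊕ dirv w
  Gb = proj₂ (step pb)
  G₄ : G a4 ≡ G a3 ⊕ dirv z
  G₄ = proj₂ (step p₃)
  cb : Class
  cb = classOf (G b)
  classb≡ : classOf (G (suc b)) ≡ classAfter cb w
  classb≡ = trans (cong classOf Gb) (classOf-step (G b) w)

  oriented-w : manhattanᵇ cb w ≡ s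
  oriented-w = trans (sym (manhattanAt-step pb)) (uo b pb)
  oriented-z : manhattanᵇ (class₃ (classAfter cb w) x u) z ≡ s
  oriented-z = trans (cong (λ c → manhattanᵇ c z) (sym (trans class₃≡ (cong (λ c → class₃ c x u) classb≡))))
                     (trans (sym (manhattanAt-step p₃)) (uo a3 p₃))

  w≢opp-x : w ≢ opp x
  w≢opp-x e = no-backtrack pb p₀ (trans step₀ (trans (sym (opp-opp x)) (cong opp (sym e))))
  w≢opp-u : w ≢ opp u
  w≢opp-u e = n≢suc[k+n] b 3 (sym (rotPath-injective p₂ (ℕP.<⇒≤ pb)
    (trans G₃≡G₀⊕u (trans (cong (_⊕ dirv u) (trans Gb (cong (λ v → G b ⊕ dirv v) e))) (step-back' (G b) u)))))
  z≢x : z ≢ x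
  z≢x e = no-backtrack p₂ p₃ (trans e (trans (sym (opp-opp x)) (cong opp (sym step₂))))
  z≢opp-u : z ≢ opp u
  z≢opp-u e = n≢suc[k+n] (suc b) 3 (sym (rotPath-injective p₃ (ℕP.<⇒≤ p₀)
    (trans G₄ (trans (cong₂ (λ p v → p ⊕ dirv v) G₃≡G₀⊕u e) (step-back (G (suc b)) u)))))

  bypass : Σ Dir (λ v → bypassDisplacement w x u z ≡ dirv v × manhattanᵇ cb v ≡ s)
  bypass = bypass-is-oriented s cb w x u z oriented-w
    (subst (λ c → manhattanᵇ c x ≡ s) classb≡ oriented₀)
    (subst (λ c → manhattanᵇ (class₁ c x u) u ≡ s) classb≡ oriented₁)
    (subst (λ c → manhattanᵇ (class₂ c x u) (opp x) ≡ s) classb≡ oriented₂)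
    oriented-z u≢x u≢opp-x w≢opp-x w≢opp-u z≢x z≢opp-u
  v : Dir
  v = proj₁ bypass

  G₄≡Gb⊕v : G a4 ≡ G b ⊕ dirv v
  G₄≡Gb⊕v = trans G₄ (trans (cong (_⊕ dirv z) (trans G₃ (cong (_⊕ dirv (opp x))
                         (trans G₂ (cong (_⊕ dirv u) (trans G₁ (cong (_⊕ dirv x) Gb)))))))
        (trans (⊕-assoc5 (G b) (dirv w) (dirv x) (dirv u) (dirv (opp x)) (dirv z))
          (cong (G b ⊕_) (proj₁ (proj₂ bypass)))))

  b+4≡ : b ℕ.+ 4 ≡ suc (suc (suc (suc b)))
  b+4≡ = ℕP.+-comm b 4
  b+4<len : b ℕ.+ 4 ℕ.< len
  b+4<len = subst (ℕ._< len) (sym b+4≡) p₃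

  open Excise sp b 4 b+4<len

  spanning : SpanningPath n I len' F'
  spanning = excised-spanning
    (subst (λ k → DAdj n (F b) (F (suc k))) (sym b+4≡) (rot-step⇒dadj v (ℕP.<⇒≤ pb) p₃ G₄≡Gb⊕v))

  skip<len : ∀ j → j ℕ.< len' → j ≢ b → skip b 4 j ℕ.< len
  skip<len j pj j≢b = subst (ℕ._≤ len) (skip-suc b 4 j j≢b) (skip-bound {suc j} pj)

  orientation : UniformOrientation s len' G'
  orientation j pj with j ℕ.≟ b
  ... | yes refl = trans (cong₂ (λ k l → manhattanStepᵇ (classOf (rot (F k))) (stepDir (rot (F k)) (rot (F l))))
                           (skip-below b 4 b ℕP.≤-refl) (trans (skip-above b 4 (suc b) (ℕP.n<1+n b)) (cong suc b+4≡)))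
                    (trans (cong (manhattanStepᵇ cb) (trans (cong (stepDir (G b)) G₄≡Gb⊕v) (stepDir-⊕ (G b) v)))
                           (proj₂ (proj₂ bypass)))
  ... | no j≢b = trans (manhattanAt-excised j j≢b) (uo (skip b 4 j) (skip<len j pj j≢b))

∸-shorter : ∀ {m} k → suc k ℕ.≤ m → m ℕ.∸ suc k ℕ.< m
∸-shorter k le = ℕP.∸-monoʳ-< (ℕ.s≤s ℕ.z≤n) le

-- A step against orientation s in a path of uniform colour code s is the
-- middle of a U-turn (misoriented-step-is-uturn), which ColourShortcut removes.
opaque
  shortcut-misoriented : ∀ {n I len F} (sp : SpanningPath n I len F) s → UniformColour s len (rotPath F) →
    ∀ i → i ℕ.< len → manhattanAt (rotPath F) i ≢ s →
    ∃[ len' ] ∃[ F' ] ((SpanningPath n I len' F' × UniformColour s len' (rotPath F')) × len' ℕ.< len)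
  shortcut-misoriented {n} {I} {len} {F} sp s uc i p misoriented =
    excise-uturn (misoriented-step-is-uturn s c (inStep G i) u (outStep len G (suc i))
                    colour-in colour-out misoriented-u (inStep≢opp i p) (outStep≢opp i p))
    where
    open PathSteps sp
    open PathStepFacts sp
    u : Dir
    u = stepAt p
    c : Class
    c = classOf (G i)
    colour-in : blueᵇ c (inStep G i) (just u) ≡ s
    colour-in = trans (cong (blueᵇ c (inStep G i)) (sym (trans (outStep-inner len G i p) (stepDir-at p)))) (uc i (ℕP.<⇒≤ p))
    colour-out : blueᵇ (classAfter c u) (just u) (outStep len G (suc i)) ≡ s
    colour-out = trans (cong₂ (λ z w → blueᵇ z w (outStep len G (suc i))) (sym (classOf-next p)) (sym (stepDir-at p)))
                       (uc (suc i) p)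
    misoriented-u : manhattanᵇ c u ≢ s
    misoriented-u e = misoriented (trans (manhattanAt-step p) e)
    excise-uturn : Σ Dir (λ x → inStep G i ≡ just x × outStep len G (suc i) ≡ just (opp x)) →
      ∃[ len' ] ∃[ F' ] ((SpanningPath n I len' F' × UniformColour s len' (rotPath F')) × len' ℕ.< len)
    excise-uturn (x , in≡x , out≡opp-x) with inStep-just i (ℕP.<⇒≤ p) in≡x | outStep-just (suc i) p out≡opp-x
    ... | a , p₀ , refl , step₀ | p₂ , step₂ =
      _ , _ , (UTurnShortcut.spanning sp a x u p₀ p p₂ step₀ refl step₂ ,
               ColourShortcut.colours sp s uc a x u p₀ p p₂ step₀ refl step₂ misoriented-u) ,
      ∸-shorter 1 (ℕP.<⇒≤ (ℕP.≤-<-trans (ℕ.s≤s (ℕ.s≤s ℕ.z≤n)) p₂))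

turn : (ℕ → Pt) → ℕ → ℤ
turn q k = cross (q k ⊖ q (k ℕ.∸ 1)) (q (suc k) ⊖ q k)

DoubleTurn : (ℕ → Pt) → ℕ → Set
DoubleTurn q k = (0ℤ ℤ.< turn q k × 0ℤ ℤ.< turn q (suc k)) ⊎ (turn q k ℤ.< 0ℤ × turn q (suc k) ℤ.< 0ℤ)

-- Two equal turns in a row at vertices a+1, a+2 make the steps x, u, opp x a
-- U-turn (two-lefts-reverse).  It does not start at vertex 0 nor end at the
-- last vertex (OrientedUTurn), so UTurnBypass removes it together with its
-- neighbouring steps.
opaque
  shortcut-double-turn : ∀ {n I len F} (sp : SpanningPath n I len F) s → UniformOrientation s len (rotPath F) →
    ∀ k → 0 ℕ.< k → suc k ℕ.< len → DoubleTurn (rotPath F) k →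
    ∃[ len' ] ∃[ F' ] ((SpanningPath n I len' F' × UniformOrientation s len' (rotPath F')) × len' ℕ.< len)
  shortcut-double-turn {n} {I} {len} {F} sp s uo (suc a) _ p₂ double = bypass a refl
    where
    open PathSteps sp
    open PathStepFacts sp
    p₁ : suc a ℕ.< len
    p₁ = ℕP.<-trans (ℕP.n<1+n (suc a)) p₂
    p₀ : a ℕ.< len
    p₀ = ℕP.<-trans (ℕP.n<1+n a) p₁
    x u y : Dir
    x = stepAt p₀
    u = stepAt p₁
    y = stepAt p₂
    step-vector : ∀ {i} (p : i ℕ.< len) → G (suc i) ⊖ G i ≡ dirv (stepAt p)
    step-vector {i} p = trans (cong (_⊖ G i) (proj₂ (step p))) (⊕⊖-cancel (G i) (dirv (stepAt p)))
    turn₁ : turn G (suc a) ≡ cross (dirv x) (dirv u)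
    turn₁ = cong₂ cross (step-vector p₀) (step-vector p₁)
    turn₂ : turn G (suc (suc a)) ≡ cross (dirv u) (dirv y)
    turn₂ = cong₂ cross (step-vector p₁) (step-vector p₂)
    y≡opp-x : DoubleTurn G (suc a) → y ≡ opp x
    y≡opp-x (inj₁ (l₁ , l₂)) = two-lefts-reverse x u y (subst (0ℤ ℤ.<_) turn₁ l₁) (subst (0ℤ ℤ.<_) turn₂ l₂)
    y≡opp-x (inj₂ (r₁ , r₂)) = two-rights-reverse x u y (subst (ℤ._< 0ℤ) turn₁ r₁) (subst (ℤ._< 0ℤ) turn₂ r₂)
    bypass : ∀ a' → a' ≡ a →
      ∃[ len' ] ∃[ F' ] ((SpanningPath n I len' F' × UniformOrientation s len' (rotPath F')) × len' ℕ.< len)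
    bypass zero e = ⊥-elim (OrientedUTurn.not-at-start sp s uo a x u p₀ p₁ p₂ refl refl (y≡opp-x double) (sym e))
    bypass (suc b) refl =
      _ , _ , (UTurnBypass.spanning sp s uo b x u p₀ p₁ p₂ refl refl (y≡opp-x double) p₃ ,
               UTurnBypass.orientation sp s uo b x u p₀ p₁ p₂ refl refl (y≡opp-x double) p₃) ,
      ∸-shorter 3 (ℕP.<⇒≤ (ℕP.≤-<-trans (ℕ.s≤s (ℕ.s≤s (ℕ.s≤s (ℕ.s≤s ℕ.z≤n)))) p₃))
      where
      p₃ : suc (suc (suc (suc b))) ℕ.< len
      p₃ = ℕP.≤∧≢⇒< p₂ (OrientedUTurn.not-at-end sp s uo (suc b) x u p₀ p₁ p₂ refl refl (y≡opp-x double))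

bounded-search : {Q : ℕ → Set} → (∀ i → Dec (Q i)) → ∀ K → (∀ i → i ℕ.< K → ¬ Q i) ⊎ Σ ℕ (λ i → i ℕ.< K × Q i)
bounded-search Q? zero = inj₁ (λ i ())
bounded-search {Q} Q? (suc K) with bounded-search Q? K
... | inj₂ (i , p , q) = inj₂ (i , ℕP.m<n⇒m<1+n p , q)
... | inj₁ none with Q? K
...   | yes q = inj₂ (K , ℕP.n<1+n K , q)
...   | no ¬q = inj₁ none≤K
  where
  none≤K : ∀ i → i ℕ.< suc K → ¬ Q i
  none≤K i p with ℕP.m<1+n⇒m<n∨m≡n p
  ... | inj₁ i<K = none i i<K
  ... | inj₂ refl = ¬q

repair : {Inv Good : ℕ → (ℕ → Pt) → Set} →
  (∀ {len F} → Inv len F → Good len F ⊎ ∃[ len' ] ∃[ F' ] (Inv len' F' × len' ℕ.< len)) →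
  ∀ {len F} → Inv len F → ∃[ len' ] ∃[ F' ] (Inv len' F' × Good len' F')
repair {Inv} {Good} improve {len} = <-rec P go len
  where
  P : ℕ → Set
  P len = ∀ {F} → Inv len F → ∃[ len' ] ∃[ F' ] (Inv len' F' × Good len' F')
  go : ∀ len → (∀ {m} → m ℕ.< len → P m) → P len
  go len shorter inv with improve inv
  ... | inj₁ good = _ , _ , inv , good
  ... | inj₂ (len' , F' , inv' , len'<len) = shorter len'<len inv'

orient : ∀ {n I} s {len F} → SpanningPath n I len F × UniformColour s len (rotPath F) →
  ∃[ len' ] ∃[ F' ] ((SpanningPath n I len' F' × UniformColour s len' (rotPath F')) × UniformOrientation s len' (rotPath F'))
orient {n} {I} s = repair improve
  where
  improve : ∀ {len F} → SpanningPath n I len F × UniformColour s len (rotPath F) →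
    UniformOrientation s len (rotPath F) ⊎
    ∃[ len' ] ∃[ F' ] ((SpanningPath n I len' F' × UniformColour s len' (rotPath F')) × len' ℕ.< len)
  improve {len} {F} (sp , uc) with bounded-search (λ i → ¬? (manhattanAt (rotPath F) i ≟ᵇ s)) len
  ... | inj₁ none = inj₁ (λ i p → Dec.decidable-stable (manhattanAt (rotPath F) i ≟ᵇ s) (none i p))
  ... | inj₂ (i , p , misoriented) = inj₂ (shortcut-misoriented sp s uc i p misoriented)

NoDoubleTurn : ℕ → (ℕ → Pt) → Set
NoDoubleTurn len q = ∀ i → 0 ℕ.< i → suc i ℕ.< len →
  ¬ (0ℤ ℤ.< turn q i × 0ℤ ℤ.< turn q (suc i)) × ¬ (turn q i ℤ.< 0ℤ × turn q (suc i) ℤ.< 0ℤ)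

DoubleTurnAt : ℕ → (ℕ → Pt) → ℕ → Set
DoubleTurnAt len q k = 0 ℕ.< k × suc k ℕ.< len × DoubleTurn q k

doubleTurnAt? : ∀ len q k → Dec (DoubleTurnAt len q k)
doubleTurnAt? len q k = (0 ℕ.<? k) ×-dec (suc k ℕ.<? len) ×-dec
  (((0ℤ ℤ.<? turn q k) ×-dec (0ℤ ℤ.<? turn q (suc k))) ⊎-dec ((turn q k ℤ.<? 0ℤ) ×-dec (turn q (suc k) ℤ.<? 0ℤ)))

straighten : ∀ {n I} s {len F} → SpanningPath n I len F × UniformOrientation s len (rotPath F) →
  ∃[ len' ] ∃[ F' ] ((SpanningPath n I len' F' × UniformOrientation s len' (rotPath F')) × NoDoubleTurn len' (rotPath F'))
straighten {n} {I} s = repair improve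
  where
  improve : ∀ {len F} → SpanningPath n I len F × UniformOrientation s len (rotPath F) →
    NoDoubleTurn len (rotPath F) ⊎
    ∃[ len' ] ∃[ F' ] ((SpanningPath n I len' F' × UniformOrientation s len' (rotPath F')) × len' ℕ.< len)
  improve {len} {F} (sp , uo) with bounded-search (doubleTurnAt? len (rotPath F)) len
  ... | inj₁ none = inj₁ (λ i p q → (λ l → none i (ℕP.<-trans (ℕP.n<1+n i) q) (p , q , inj₁ l)) ,
                                    (λ r → none i (ℕP.<-trans (ℕP.n<1+n i) q) (p , q , inj₂ r)))
  ... | inj₂ (k , _ , (0<k , k+1<len , double)) = inj₂ (shortcut-double-turn sp s uo k 0<k k+1<len double)

notT : ∀ {b} → not b ≡ true → b ≡ false
notT {false} _ = refl

manhattan-edge : ∀ q u → manhattanᵇ (classOf q) u ≡ true → MEdge q (q ⊕ dirv u)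
manhattan-edge (a , b) R h = inj₁ (refl , par⇒EvenZ b (notT h))
manhattan-edge (a , b) L h = inj₂ (inj₁ (refl , par⇒OddZ b h))
manhattan-edge (a , b) U h = inj₂ (inj₂ (inj₁ (refl , par⇒EvenZ a (notT h))))
manhattan-edge (a , b) D h = inj₂ (inj₂ (inj₂ (refl , par⇒OddZ a h)))

sub-suc : ∀ m i → i ℕ.< m → m ℕ.∸ i ≡ suc (m ℕ.∸ suc i)
sub-suc (suc m) zero _ = refl
sub-suc (suc m) (suc i) (ℕ.s≤s p) = sub-suc m i p

cross-reverse : ∀ A B C → cross (B ⊖ C) (A ⊖ B) ≡ - cross (B ⊖ A) (C ⊖ B)
cross-reverse (a1 , a2) (b1 , b2) (c1 , c2) = ring a1 a2 b1 b2 c1 c2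
  where
  ring : ∀ a1 a2 b1 b2 c1 c2 →
    (b1 - c1) * (a2 - b2) - (b2 - c2) * (a1 - b1) ≡ - ((b1 - a1) * (c2 - b2) - (b2 - a2) * (c1 - b1))
  ring = solve-∀

0<-⇒<0 : ∀ {a} → 0ℤ ℤ.< - a → a ℤ.< 0ℤ
0<-⇒<0 {a} h = subst (ℤ._< 0ℤ) (ℤP.neg-involutive a) (ℤP.neg-mono-< h)

-<0⇒0< : ∀ {a} → - a ℤ.< 0ℤ → 0ℤ ℤ.< a
-<0⇒0< {a} h = subst (0ℤ ℤ.<_) (ℤP.neg-involutive a) (ℤP.neg-mono-< h)

module TaxiWalks {n : ℕ} {I : Pt → Set} {len : ℕ} {F : ℕ → Pt} (sp : SpanningPath n I len F) where
  open PathSteps sp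
  open PathStepFacts sp

  taxi-forward : UniformOrientation true len G → NoDoubleTurn len G → TaxiWalkFrom len (λ i → rot (F i))
  taxi-forward uo ndt = edges , (λ i j p q e → rotPath-injective p q e) , ndt
    where
    edges : ∀ i → i ℕ.< len → MEdge (G i) (G (suc i))
    edges i p = subst (MEdge (G i)) (sym (proj₂ (step p)))
                  (manhattan-edge (G i) (stepAt p) (trans (sym (manhattanAt-step p)) (uo i p)))

  taxi-backward : UniformOrientation false len G → NoDoubleTurn len G → TaxiWalkFrom len (λ i → rot (reversePath len F i))
  taxi-backward uo ndt = edges , injective , no-double-turn
    where
    G⁻ : ℕ → Pt
    G⁻ i = G (len ℕ.∸ i)
    edges : ∀ i → i ℕ.< len → MEdge (G⁻ i) (G⁻ (suc i))
    edges i p = subst (λ k → MEdge (G k) (G (len ℕ.∸ suc i))) (sym (sub-suc len i p)) reversed-edge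
      where
      j = len ℕ.∸ suc i
      pj : j ℕ.< len
      pj = subst (ℕ._≤ len) (sub-suc len i p) (ℕP.m∸n≤m len i)
      u = stepAt pj
      reversed-edge : MEdge (G (suc j)) (G j)
      reversed-edge = subst (MEdge (G (suc j))) (trans (cong (_⊕ dirv (opp u)) (proj₂ (step pj))) (step-back (G j) u))
            (manhattan-edge (G (suc j)) (opp u) (trans (cong (λ c → manhattanᵇ c (opp u)) (classOf-next pj))
               (trans (manhattan-reverse (classOf (G j)) u) (cong not (trans (sym (manhattanAt-step pj)) (uo j pj))))))
    injective : ∀ i j → i ℕ.≤ len → j ℕ.≤ len → G⁻ i ≡ G⁻ j → i ≡ j
    injective i j p q e = ℕP.∸-cancelˡ-≡ p q (rotPath-injective (ℕP.m∸n≤m len i) (ℕP.m∸n≤m len j) e)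
    no-double-turn : NoDoubleTurn len G⁻
    no-double-turn (suc k) _ qk =
      (λ h → proj₂ (ndt j pj0 pj1) (0<-⇒<0 (subst (0ℤ ℤ.<_) turn₂ (proj₂ h)) , 0<-⇒<0 (subst (0ℤ ℤ.<_) turn₁ (proj₁ h)))) ,
      (λ h → proj₁ (ndt j pj0 pj1) (-<0⇒0< (subst (ℤ._< 0ℤ) turn₂ (proj₂ h)) , -<0⇒0< (subst (ℤ._< 0ℤ) turn₁ (proj₁ h))))
      where
      j = len ℕ.∸ suc (suc k)
      i1 : len ℕ.∸ suc k ≡ suc j
      i1 = sub-suc len (suc k) (ℕP.<-trans (ℕP.n<1+n (suc k)) qk)
      i2 : len ℕ.∸ k ≡ suc (suc j)
      i2 = trans (sub-suc len k (ℕP.<-trans (ℕP.n<1+n k) (ℕP.<-trans (ℕP.n<1+n (suc k)) qk))) (cong suc i1)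
      i3 : len ℕ.∸ suc (suc (suc k)) ≡ j ℕ.∸ 1
      i3 = sym (trans (ℕP.∸-+-assoc len (suc (suc k)) 1) (cong (len ℕ.∸_) (ℕP.+-comm (suc (suc k)) 1)))
      pj0 : 0 ℕ.< j
      pj0 = ℕP.m<n⇒0<n∸m qk
      pj1 : suc j ℕ.< len
      pj1 = subst (ℕ._< len) i1 (ℕP.∸-monoʳ-< (ℕ.s≤s ℕ.z≤n) (ℕP.<⇒≤ (ℕP.<-trans (ℕP.n<1+n (suc k)) qk)))
      turn₁ : turn G⁻ (suc k) ≡ - turn G (suc j)
      turn₁ = trans (cong₂ (λ a b → cross (G a ⊖ G b) (G j ⊖ G a)) i1 i2) (cross-reverse (G j) (G (suc j)) (G (suc (suc j))))
      turn₂ : turn G⁻ (suc (suc k)) ≡ - turn G j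
      turn₂ = trans (cong₂ (λ a b → cross (G j ⊖ G a) (G b ⊖ G j)) i1 i3) (cross-reverse (G (j ℕ.∸ 1)) (G j) (G (suc j)))

single-vertex-taxi : ∀ q → TaxiWalkFrom 0 q
single-vertex-taxi q = (λ i ()) , (λ i j p q _ → trans (ℕP.n≤0⇒n≡0 p) (sym (ℕP.n≤0⇒n≡0 q))) , (λ i _ ())

-- The two phases together: a spanning path of uniform colour code s can be
-- shortcut to one with uniform orientation s and no double turn.  (Opaque, so
-- that type checking never unfolds the well-founded recursion of repair.)
opaque
  taxi-shape : ∀ {n I len F} s → SpanningPath n I len F → UniformColour s len (rotPath F) →
    ∃[ len' ] ∃[ F' ] (SpanningPath n I len' F' × UniformOrientation s len' (rotPath F') × NoDoubleTurn len' (rotPath F'))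
  taxi-shape s sp uc with orient s (sp , uc)
  ... | _ , _ , (sp₁ , _) , uo₁ with straighten s (sp₁ , uo₁)
  ...   | len₂ , F₂ , (sp₂ , uo₂) , ndt₂ = len₂ , F₂ , sp₂ , uo₂ , ndt₂

oriented-fault-line : ∀ {n I len F} s → SpanningPath n I len F → UniformOrientation s len (rotPath F) →
  FaultLine n I len F
oriented-fault-line s sp uo = sp , λ i j p _ alt _ →
  ⊥-elim (PathColours.no-alternation sp s (PathColours.orientation⇒colour sp s (ℕP.≤-<-trans ℕ.z≤n p) uo) i p alt)

oriented-taxi-walk : ∀ {n I len F} s → SpanningPath n I len F → UniformOrientation s len (rotPath F) →
  NoDoubleTurn len (rotPath F) →
  TaxiWalkFrom len (λ i → rot (F i)) ⊎ TaxiWalkFrom len (λ i → rot (reversePath len F i))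
oriented-taxi-walk true sp uo ndt = inj₁ (TaxiWalks.taxi-forward sp uo ndt)
oriented-taxi-walk false sp uo ndt = inj₂ (TaxiWalks.taxi-backward sp uo ndt)

uniform⇒taxi-fault-line : ∀ {n I len F} s → SpanningPath n I len F → UniformColour s len (rotPath F) →
  ∃[ len' ] ∃[ F' ] (FaultLine n I len' F' ×
    (TaxiWalkFrom len' (λ i → rot (F' i)) ⊎ TaxiWalkFrom len' (λ i → rot (reversePath len' F' i))))
uniform⇒taxi-fault-line s sp uc with taxi-shape s sp uc
... | len' , F' , sp' , uo , ndt = len' , F' , oriented-fault-line s sp' uo , oriented-taxi-walk s sp' uo ndt

lemma2p3 : (n : ℕ) (I : Pt → Set) → IndependentSet n I →
    (∃[ len ] ∃[ F ] (FaultLine n I len F × NoAlternation n len F)) →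
    ∃[ len ] ∃[ F ] (FaultLine n I len F ×
      (TaxiWalkFrom len (λ i → rot (F i))
       ⊎ TaxiWalkFrom len (λ i → rot (reversePath len F i))))
lemma2p3 n I _ (zero , F , fault-line , _) = zero , F , fault-line , inj₁ (single-vertex-taxi (λ i → rot (F i)))
lemma2p3 n I _ (suc l , F , (sp , _) , no-alternation) = uniform⇒taxi-fault-line (blueAt (suc l) (rotPath F) 0) sp
  (PathColours.colour-uniform sp (ℕ.s≤s ℕ.z≤n) no-alternation)
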